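{- Let $(S,\mathcal B)$ be a Steiner triple system of order $21$ with a flower $\{A,B,C,D\}$ with stem $D$, and let $\mathcal T\subseteq\mathcal B$ be the transversal subdesign TD$(3,6)$ of $\mathcal B$ with groups $A,B,C$. Let $D'$ be a $3$-subset of $A$. Then $\mathcal B$ has a second sub-TD$(3,6)$ $\mathcal T'\neq\mathcal T$ with support $S\setminus D'$ if and only if $\mathcal B$ contains disjoint blocks $B_0,B_1\subset B$ and disjoint blocks $C_0,C_1\subset C$ such that $\mathcal T$ is partitioned into four sub-TD$(3,3)$, each having one group from $\{D',A\setminus D'\}$, one from $\{B_0,B_1\}$ and one from $\{C_0,C_1\}$.
   Context: A Steiner triple system (STS) on $S$ is a set of 3-subsets (blocks) of $S$ such that any two distinct points lie in exactly one block; STS$(v)$ means $|S|=v$. A sub-STS$(9)$ of $\mathcal B$ is a subset of $\mathcal B$ forming an STS$(9)$ on some 9-set (its support). An almost-sub-STS of $\mathcal B$ is a subset of the form $\mathcal C'\setminus\{T\}$ where $\mathcal C'$ is an STS on some set (the support) and $T\in\mathcal C'$ (the missing triple, not necessarily in $\mathcal B$). A TD$(3,w)$ with groups $X,Y,Z$ (disjoint $w$-sets) is a set of 3-subsets each meeting each group in one point such that any two points from different groups lie in exactly one of them; its support is $X\cup Y\cup Z$; a sub-TD of a set of triples is a subset that is such a design. For an STS$(21)$ $(S,\mathcal B)$, a partition of $S$ into sets $A,B,C,D$ of sizes $6,6,6,3$ is a flower with stem $D$ and petals $A,B,C$ if $\mathcal B$ contains one sub-STS$(9)$ and two almost-sub-STS$(9)$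 whose supports are $A\cup D$, $B\cup D$, $C\cup D$ (in some order), where the missing triple of each of these two almost-sub-STS is $D$ (whether or not $D\in\mathcal B$). -}

module Defs where

open import Data.Nat using (ℕ)
open import Data.Bool using (Bool; true)
open import Data.Fin using (Fin)
open import Data.Fin.Subset using (Subset; _∈_; _∉_; _⊆_; _∩_; _∪_; ∣_∣; ∁; _─_)
open import Data.Product using (Σ; _×_; Σ-syntax)
open import Data.Sum using (_⊎_)
open import Relation.Binary.PropositionalEquality using (_≡_; _≢_)
open import Relation.Nullary using (¬_)

-- Points of a design on n points are elements of Fin n; point sets are
-- subsets (Data.Fin.Subset).
Family : ℕ → Set
Family n = Subset n → Bool

module _ {n : ℕ} where

  _∈ᶠ_ : Subset n → Family n → Set
  X ∈ᶠ F = F X ≡ true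

  _⊆ᶠ_ : Family n → Family n → Set
  F ⊆ᶠ G = ∀ X → X ∈ᶠ F → X ∈ᶠ G

  _≐ᶠ_ : Family n → Family n → Set
  F ≐ᶠ G = ∀ X → F X ≡ G X

  Disjoint : Subset n → Subset n → Set
  Disjoint X Y = ∀ x → x ∈ X → x ∉ Y

  ExactlyOneBlock : Family n → Fin n → Fin n → Set
  ExactlyOneBlock F x y =
    Σ[ X ∈ Subset n ] (X ∈ᶠ F × x ∈ X × y ∈ X ×
      (∀ Y → Y ∈ᶠ F → x ∈ Y → y ∈ Y → Y ≡ X))

  IsSTS : Subset n → Family n → Set
  IsSTS P F =
    (∀ X → X ∈ᶠ F → ∣ X ∣ ≡ 3 × X ⊆ P) ×
    (∀ x y → x ∈ P → y ∈ P → x ≢ y → ExactlyOneBlock F x y)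

  IsTD : ℕ → Subset n → Subset n → Subset n → Family n → Set
  IsTD w X Y Z F =
    ∣ X ∣ ≡ w × ∣ Y ∣ ≡ w × ∣ Z ∣ ≡ w ×
    Disjoint X Y × Disjoint X Z × Disjoint Y Z ×
    (∀ T → T ∈ᶠ F → ∣ T ∣ ≡ 3 × ∣ T ∩ X ∣ ≡ 1 × ∣ T ∩ Y ∣ ≡ 1 × ∣ T ∩ Z ∣ ≡ 1) ×
    (∀ x y → (x ∈ X × y ∈ Y) ⊎ (x ∈ X × y ∈ Z) ⊎ (x ∈ Y × y ∈ Z) →
      ExactlyOneBlock F x y)

  HasSubSTS9 : Family n → Subset n → Set
  HasSubSTS9 𝓑 P = ∣ P ∣ ≡ 9 × Σ[ 𝓒 ∈ Family n ] (𝓒 ⊆ᶠ 𝓑 × IsSTS P 𝓒)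

  HasAlmostSubSTS9 : Family n → Subset n → Subset n → Set
  HasAlmostSubSTS9 𝓑 P T =
    ∣ P ∣ ≡ 9 × Σ[ 𝓒' ∈ Family n ]
      (IsSTS P 𝓒' × T ∈ᶠ 𝓒' × (∀ X → X ∈ᶠ 𝓒' → X ≢ T → X ∈ᶠ 𝓑))

  IsFlower : Family n → Subset n → Subset n → Subset n → Subset n → Set
  IsFlower 𝓑 A B C D =
    ∣ A ∣ ≡ 6 × ∣ B ∣ ≡ 6 × ∣ C ∣ ≡ 6 × ∣ D ∣ ≡ 3 ×
    Disjoint A B × Disjoint A C × Disjoint A D ×
    Disjoint B C × Disjoint B D × Disjoint C D ×
    (∀ x → x ∈ A ⊎ x ∈ B ⊎ x ∈ C ⊎ x ∈ D) ×
    ((HasSubSTS9 𝓑 (A ∪ D) × HasAlmostSubSTS9 𝓑 (B ∪ D) D × HasAlmostSubSTS9 𝓑 (C ∪ D) D)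
     ⊎ (HasAlmostSubSTS9 𝓑 (A ∪ D) D × HasSubSTS9 𝓑 (B ∪ D) × HasAlmostSubSTS9 𝓑 (C ∪ D) D)
     ⊎ (HasAlmostSubSTS9 𝓑 (A ∪ D) D × HasAlmostSubSTS9 𝓑 (B ∪ D) D × HasSubSTS9 𝓑 (C ∪ D)))

  HasOtherSubTD36 : Family n → Family n → Subset n → Set
  HasOtherSubTD36 𝓑 𝓣 P =
    Σ[ 𝓣' ∈ Family n ] Σ[ X ∈ Subset n ] Σ[ Y ∈ Subset n ] Σ[ Z ∈ Subset n ]
      (𝓣' ⊆ᶠ 𝓑 × IsTD 6 X Y Z 𝓣' × X ∪ Y ∪ Z ≡ P × ¬ (𝓣' ≐ᶠ 𝓣))

  IsPartition4 : Family n → (Fin 4 → Family n) → Set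
  IsPartition4 𝓣 𝓟 =
    (∀ i → 𝓟 i ⊆ᶠ 𝓣) ×
    (∀ X → X ∈ᶠ 𝓣 → Σ[ i ∈ Fin 4 ] X ∈ᶠ 𝓟 i) ×
    (∀ i j X → X ∈ᶠ 𝓟 i → X ∈ᶠ 𝓟 j → i ≡ j)

  SplitCondition : Family n → Family n → Subset n → Subset n → Subset n → Subset n → Set
  SplitCondition 𝓑 𝓣 A B C D' =
    Σ[ B₀ ∈ Subset n ] Σ[ B₁ ∈ Subset n ] Σ[ C₀ ∈ Subset n ] Σ[ C₁ ∈ Subset n ]
      (B₀ ∈ᶠ 𝓑 × B₁ ∈ᶠ 𝓑 × B₀ ⊆ B × B₁ ⊆ B × Disjoint B₀ B₁ ×
       C₀ ∈ᶠ 𝓑 × C₁ ∈ᶠ 𝓑 × C₀ ⊆ C × C₁ ⊆ C × Disjoint C₀ C₁ ×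
       Σ[ 𝓟 ∈ (Fin 4 → Family n) ]
         (IsPartition4 𝓣 𝓟 ×
          (∀ i → Σ[ G₁ ∈ Subset n ] Σ[ G₂ ∈ Subset n ] Σ[ G₃ ∈ Subset n ]
             ((G₁ ≡ D' ⊎ G₁ ≡ A ─ D') × (G₂ ≡ B₀ ⊎ G₂ ≡ B₁) ×
              (G₃ ≡ C₀ ⊎ G₃ ≡ C₁) × IsTD 3 G₁ G₂ G₃ (𝓟 i)))))

module Submission where

-- Write A' = A ∖ D'. Call a splitting a choice of disjoint blocks B₀, B₁ ⊆ B and C₀, C₁ ⊆ C such
-- that every block {a, b, c} of 𝓣 (a ∈ A, b ∈ B, c ∈ C) has c ∈ C₀ exactly when a ∈ D' ⇔ b ∈ B₀.
-- Both sides of the equivalence amount to the existence of a splitting.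
--
-- A splitting cuts 𝓣 into the four sub-TD(3,3)s with groups (D', B₀, C₀), (D', B₁, C₁),
-- (A', B₀, C₁), (A', B₁, C₀), and conversely such a partition forces the rule. A splitting also
-- yields a second TD(3,6) with groups A' ∪ D, B₀ ∪ C₀, B₁ ∪ C₁: the blocks of 𝓣 meeting A',
-- together with the blocks of 𝓑 through the stem D meeting both B₀ and B₁ or both C₀ and C₁;
-- enough of the latter exist because B ∪ D and C ∪ D carry (almost) sub-STS(9)s.
--
-- Conversely, let 𝓣' be a TD(3,6) of 𝓑 on S ∖ D'. Its blocks avoid D', so the two other points of
-- a block of 𝓣 through D' lie in a common group of 𝓣'. Following the three blocks of 𝓣 through
-- b ∈ B and D', and then those through one of the points of C so reached, shows that the group G
-- of b consists of three points of B and three of C; closure in the petals makes G ∩ B and G ∩ C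
-- blocks. Two groups meeting B give the splitting; the rule holds because the three blocks of 𝓣
-- through b ∈ G ∩ B and D' already meet C in all of G ∩ C.

open import Defs
open import Data.Bool using (true)
open import Data.Bool.Properties using (T-≡) renaming (_≟_ to _≟ᵇ_)
open import Data.Empty using (⊥; ⊥-elim)
open import Data.Fin using (Fin; zero; suc; _≟_)
open import Data.Fin.Patterns using (0F; 1F; 2F; 3F)
open import Data.Fin.Subset
  using (Subset; _∈_; _∉_; _⊆_; _∩_; _∪_; _─_; _-_; ∣_∣; ⁅_⁆; ∁; ⊤; Nonempty; inside; outside)
open import Data.Fin.Subset.Properties
  using ( _∈?_; ∈⊤; nonempty?; Empty-unique; drop-there; ⊆-antisym; ∣⊥∣≡0; ∣⁅x⁆∣≡1; x∈⁅x⁆; x∈⁅y⁆⇒x≡y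
        ; x∈p∩q⁺; x∈p∩q⁻; x∈p∪q⁺; x∈p∪q⁻; p─⊥≡p; p─q⊆p; x∈p∧x∉q⇒x∈p─q; x∈p∧x≢y⇒x∈p-y
        ; x∈∁p⇒x∉p; x∉p⇒x∈∁p; x∈p⇒∣p-x∣<∣p∣; p⊂q⇒∣p∣<∣q∣; p⊆q⇒∣p∣≤∣q∣)
open import Data.List using (List; []; _∷_; length; _++_)
open import Data.List.Membership.Propositional using () renaming (_∈_ to _∈ₗ_; _∉_ to _∉ₗ_)
open import Data.List.Membership.Propositional.Properties using (∈-++⁻)
open import Data.List.Relation.Unary.All as All using (All; []; _∷_)
open import Data.List.Relation.Unary.All.Properties using (¬Any⇒All¬) renaming (++⁺ to All-++⁺)
open import Data.List.Relation.Unary.Any using (here; there; any?)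
open import Data.List.Relation.Unary.AllPairs using ([]; _∷_)
open import Data.List.Relation.Unary.Unique.Propositional using (Unique)
import Data.List.Relation.Unary.Unique.Propositional.Properties as Unique
open import Data.Nat using (ℕ; suc; _+_; _∸_; _≤_; _<_; z≤n; s≤s)
open import Data.Nat.Properties using (≤-pred; ≤-trans; ≤-reflexive; <-irrefl; n≤1+n; +-suc; m+n∸n≡m)
open import Data.Product using (Σ-syntax; _×_; _,_; proj₁; proj₂)
open import Data.Sum using (_⊎_; inj₁; inj₂; swap; map₂)
open import Data.Vec using ([]; _∷_)
import Data.Vec as Vec
open import Function using (_∘_; id)
open import Function.Bundles using (_⇔_; mk⇔; Equivalence)
open import Relation.Nullary using (¬_; Dec; yes; no)
open import Relation.Nullary.Decidable using (⌊_⌋; fromWitness; toWitness; toSum; _×-dec_; _⊎-dec_)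
open import Relation.Unary using (Decidable)
open import Relation.Binary.PropositionalEquality
  using (_≡_; _≢_; refl; sym; trans; cong; cong₂; subst; subst₂; module ≡-Reasoning)

private variable
  n : ℕ
  x y : Fin n
  p q r : Subset n

x∈p─q⇒x∉q : x ∈ p ─ q → x ∉ q
x∈p─q⇒x∉q {x = zero} {p = _ ∷ _} {q = outside ∷ _} _ ()
x∈p─q⇒x∉q {x = suc x} {p = _ ∷ _} {q = _ ∷ _} (Vec.there x∈) (Vec.there x∈q) = x∈p─q⇒x∉q x∈ x∈q

∩⁺ : x ∈ p → x ∈ q → x ∈ p ∩ q
∩⁺ x∈p x∈q = x∈p∩q⁺ (x∈p , x∈q)

∩⁻ˡ : x ∈ p ∩ q → x ∈ p
∩⁻ˡ = proj₁ ∘ x∈p∩q⁻ _ _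

∩⁻ʳ : x ∈ p ∩ q → x ∈ q
∩⁻ʳ = proj₂ ∘ x∈p∩q⁻ _ _

∪⁺ˡ : x ∈ p → x ∈ p ∪ q
∪⁺ˡ = x∈p∪q⁺ ∘ inj₁

∪⁺ʳ : x ∈ q → x ∈ p ∪ q
∪⁺ʳ = x∈p∪q⁺ ∘ inj₂

∪⁻ : x ∈ p ∪ q → x ∈ p ⊎ x ∈ q
∪⁻ = x∈p∪q⁻ _ _

─⁻ˡ : x ∈ p ─ q → x ∈ p
─⁻ˡ = p─q⊆p _ _

either-⊆ : ∀ {G} → G ≡ p ⊎ G ≡ q → p ⊆ r → q ⊆ r → G ⊆ r
either-⊆ (inj₁ refl) p⊆r _ = p⊆r
either-⊆ (inj₂ refl) _ q⊆r = q⊆r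

Disjoint-sym : Disjoint p q → Disjoint q p
Disjoint-sym p∩q≡∅ x x∈q x∈p = p∩q≡∅ x x∈p x∈q

Disjoint⇒≢ : Disjoint p q → x ∈ p → y ∈ q → x ≢ y
Disjoint⇒≢ p∩q≡∅ x∈p y∈q refl = p∩q≡∅ _ x∈p y∈q

Disjoint-⊆ : ∀ {p' q'} → p ⊆ p' → q ⊆ q' → Disjoint p' q' → Disjoint p q
Disjoint-⊆ p⊆p' q⊆q' p'∩q'≡∅ x x∈p x∈q = p'∩q'≡∅ x (p⊆p' x∈p) (q⊆q' x∈q)

Disjoint-∪ˡ : Disjoint p r → Disjoint q r → Disjoint (p ∪ q) r
Disjoint-∪ˡ p∩r≡∅ q∩r≡∅ x x∈p∪q x∈r with ∪⁻ x∈p∪q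
... | inj₁ x∈p = p∩r≡∅ x x∈p x∈r
... | inj₂ x∈q = q∩r≡∅ x x∈q x∈r

Disjoint-∪ʳ : Disjoint p q → Disjoint p r → Disjoint p (q ∪ r)
Disjoint-∪ʳ p∩q≡∅ p∩r≡∅ = Disjoint-sym (Disjoint-∪ˡ (Disjoint-sym p∩q≡∅) (Disjoint-sym p∩r≡∅))

∣p∣≤1+∣p-x∣ : ∀ (p : Subset n) x → ∣ p ∣ ≤ suc ∣ p - x ∣
∣p∣≤1+∣p-x∣ (inside ∷ p) zero = s≤s (≤-reflexive (cong ∣_∣ (sym (p─⊥≡p p))))
∣p∣≤1+∣p-x∣ (outside ∷ p) zero = ≤-trans (≤-reflexive (cong ∣_∣ (sym (p─⊥≡p p)))) (n≤1+n _)
∣p∣≤1+∣p-x∣ (inside ∷ p) (suc x) = s≤s (∣p∣≤1+∣p-x∣ p x)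
∣p∣≤1+∣p-x∣ (outside ∷ p) (suc x) = ∣p∣≤1+∣p-x∣ p x

length≤∣∣ : ∀ {xs : List (Fin n)} → Unique xs → All (_∈ p) xs → length xs ≤ ∣ p ∣
length≤∣∣ [] [] = z≤n
length≤∣∣ (x∉xs ∷ xs!) (x∈p ∷ xs⊆p) =
  ≤-trans (s≤s (length≤∣∣ xs! (All.zipWith (λ (x≢y , y∈p) → x∈p∧x≢y⇒x∈p-y y∈p (x≢y ∘ sym)) (x∉xs , xs⊆p))))
          (x∈p⇒∣p-x∣<∣p∣ x∈p)

-- Witnesses are opaque: `with` over an unfolded existence proof is very slow to check.
opaque
  ∣p∣>0⇒nonempty : ∀ {n} {p : Subset n} → 0 < ∣ p ∣ → Nonempty p
  ∣p∣>0⇒nonempty {n = n} {p = p} 0<∣p∣ with nonempty? p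
  ... | yes p≢∅ = p≢∅
  ... | no p≡∅ = ⊥-elim (<-irrefl (sym (trans (cong ∣_∣ (Empty-unique p≡∅)) (∣⊥∣≡0 n))) 0<∣p∣)

∣p∣≡1+k⇒nonempty : ∀ {k} → ∣ p ∣ ≡ suc k → Nonempty p
∣p∣≡1+k⇒nonempty ∣p∣≡1+k = ∣p∣>0⇒nonempty (subst (0 <_) (sym ∣p∣≡1+k) (s≤s z≤n))

opaque
  fresh : ∀ (xs : List (Fin n)) → length xs < ∣ p ∣ → Σ[ x ∈ Fin n ] (x ∈ p × x ∉ₗ xs)
  fresh [] 0<∣p∣ with ∣p∣>0⇒nonempty 0<∣p∣
  ... | x , x∈p = x , x∈p , λ ()
  fresh {p = p} (y ∷ ys) lt with fresh {p = p - y} ys (≤-pred (≤-trans lt (∣p∣≤1+∣p-x∣ p y)))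
  ... | x , x∈p-y , x∉ys = x , p─q⊆p p ⁅ y ⁆ x∈p-y , λ
    { (here refl) → x∈p─q⇒x∉q x∈p-y (x∈⁅x⁆ x)
    ; (there x∈ys) → x∉ys x∈ys }

opaque
  third-point : ∣ p ∣ ≡ 3 → ∀ x y → Σ[ z ∈ Fin n ] (z ∈ p × z ≢ x × z ≢ y)
  third-point ∣p∣≡3 x y with fresh (x ∷ y ∷ []) (subst (2 <_) (sym ∣p∣≡3) (s≤s (s≤s (s≤s z≤n))))
  ... | z , z∈p , z∉xy = z , z∈p , z∉xy ∘ here , z∉xy ∘ there ∘ here

opaque
  three-points : ∣ p ∣ ≡ 3 → Σ[ a ∈ Fin n ] Σ[ b ∈ Fin n ] Σ[ c ∈ Fin n ]
                   (Unique (a ∷ b ∷ c ∷ []) × All (_∈ p) (a ∷ b ∷ c ∷ []))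
  three-points ∣p∣≡3 with fresh [] (subst (0 <_) (sym ∣p∣≡3) (s≤s z≤n))
  ... | a , a∈p , _ with fresh (a ∷ []) (subst (1 <_) (sym ∣p∣≡3) (s≤s (s≤s z≤n)))
  ... | b , b∈p , b∉a with fresh (b ∷ a ∷ []) (subst (2 <_) (sym ∣p∣≡3) (s≤s (s≤s (s≤s z≤n))))
  ... | c , c∈p , c∉ba =
    a , b , c , ((b∉a ∘ here ∘ sym) ∷ (c∉ba ∘ there ∘ here ∘ sym) ∷ []) ∷ ((c∉ba ∘ here ∘ sym) ∷ []) ∷ [] ∷ [] ,
    a∈p ∷ b∈p ∷ c∈p ∷ []

∣p∣≡length⇒⊆ : ∀ {xs} → Unique xs → All (_∈ p) xs → ∣ p ∣ ≡ length xs → x ∈ p → x ∈ₗ xs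
∣p∣≡length⇒⊆ {x = x} {xs = xs} xs! xs⊆p ∣p∣≡ x∈p with any? (x ≟_) xs
... | yes x∈xs = x∈xs
... | no x∉xs = ⊥-elim (<-irrefl (sym ∣p∣≡) (length≤∣∣ (¬Any⇒All¬ xs x∉xs ∷ xs!) (x∈p ∷ xs⊆p)))

∣p∣≡1⇒≡ : ∣ p ∣ ≡ 1 → x ∈ p → y ∈ p → x ≡ y
∣p∣≡1⇒≡ {x = x} {y = y} ∣p∣≡1 x∈p y∈p with x ≟ y
... | yes x≡y = x≡y
... | no x≢y = ⊥-elim (<-irrefl refl (≤-trans (length≤∣∣ ((x≢y ∷ []) ∷ [] ∷ []) (x∈p ∷ y∈p ∷ [])) (≤-reflexive ∣p∣≡1)))

∣p∣≡1 : x ∈ p → (∀ {y} → y ∈ p → y ≡ x) → ∣ p ∣ ≡ 1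
∣p∣≡1 {x = x} {p = p} x∈p only = trans (cong ∣_∣ (⊆-antisym p⊆⁅x⁆ ⁅x⁆⊆p)) (∣⁅x⁆∣≡1 x)
  where
  p⊆⁅x⁆ : p ⊆ ⁅ x ⁆
  p⊆⁅x⁆ y∈p = subst (_∈ ⁅ x ⁆) (sym (only y∈p)) (x∈⁅x⁆ x)
  ⁅x⁆⊆p : ⁅ x ⁆ ⊆ p
  ⁅x⁆⊆p y∈⁅x⁆ = subst (_∈ p) (sym (x∈⁅y⁆⇒x≡y x y∈⁅x⁆)) x∈p

∣∩∣≡1 : ∀ {T S : Subset n} {a} {xs : List (Fin n)} → (∀ {y} → y ∈ T → y ∈ₗ xs) →
        All (λ y → y ≡ a ⊎ y ∉ S) xs → a ∈ T ∩ S → ∣ T ∩ S ∣ ≡ 1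
∣∩∣≡1 T⊆xs others∉S a∈T∩S = ∣p∣≡1 a∈T∩S only-a
  where
  only-a : ∀ {y} → y ∈ _ → y ≡ _
  only-a y∈T∩S with All.lookup others∉S (T⊆xs (∩⁻ˡ y∈T∩S))
  ... | inj₁ y≡a = y≡a
  ... | inj₂ y∉S = ⊥-elim (y∉S (∩⁻ʳ y∈T∩S))

transversal-block : ∀ {T X Y Z : Subset n} {x y z} → ∣ T ∣ ≡ 3 → Disjoint X Y → Disjoint X Z → Disjoint Y Z →
                    x ∈ T ∩ X → y ∈ T ∩ Y → z ∈ T ∩ Z → ∣ T ∩ X ∣ ≡ 1 × ∣ T ∩ Y ∣ ≡ 1 × ∣ T ∩ Z ∣ ≡ 1
transversal-block {T = T} {X} {Y} {Z} {x} {y} {z} ∣T∣≡3 X∩Y≡∅ X∩Z≡∅ Y∩Z≡∅ x∈ y∈ z∈ =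
  ∣∩∣≡1 T⊆xyz (inj₁ refl ∷ inj₂ (λ y∈X → X∩Y≡∅ _ y∈X y∈Y) ∷ inj₂ (λ z∈X → X∩Z≡∅ _ z∈X z∈Z) ∷ []) x∈ ,
  ∣∩∣≡1 T⊆xyz (inj₂ (X∩Y≡∅ _ x∈X) ∷ inj₁ refl ∷ inj₂ (λ z∈Y → Y∩Z≡∅ _ z∈Y z∈Z) ∷ []) y∈ ,
  ∣∩∣≡1 T⊆xyz (inj₂ (X∩Z≡∅ _ x∈X) ∷ inj₂ (Y∩Z≡∅ _ y∈Y) ∷ inj₁ refl ∷ []) z∈
  where
  x∈X : x ∈ X
  x∈X = ∩⁻ʳ x∈
  y∈Y : y ∈ Y
  y∈Y = ∩⁻ʳ y∈
  z∈Z : z ∈ Z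
  z∈Z = ∩⁻ʳ z∈
  T⊆xyz : ∀ {w} → w ∈ T → w ∈ₗ x ∷ y ∷ z ∷ []
  T⊆xyz = ∣p∣≡length⇒⊆ ((Disjoint⇒≢ X∩Y≡∅ x∈X y∈Y ∷ Disjoint⇒≢ X∩Z≡∅ x∈X z∈Z ∷ [])
                          ∷ (Disjoint⇒≢ Y∩Z≡∅ y∈Y z∈Z ∷ []) ∷ [] ∷ [])
                       (∩⁻ˡ x∈ ∷ ∩⁻ˡ y∈ ∷ ∩⁻ˡ z∈ ∷ []) ∣T∣≡3

∣p─q∣+∣q∣≡∣p∣ : ∀ (p q : Subset n) → q ⊆ p → ∣ p ─ q ∣ + ∣ q ∣ ≡ ∣ p ∣
∣p─q∣+∣q∣≡∣p∣ [] [] _ = refl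
∣p─q∣+∣q∣≡∣p∣ (inside ∷ p) (inside ∷ q) q⊆p =
  trans (+-suc ∣ p ─ q ∣ ∣ q ∣) (cong suc (∣p─q∣+∣q∣≡∣p∣ p q (drop-there ∘ q⊆p ∘ Vec.there)))
∣p─q∣+∣q∣≡∣p∣ (outside ∷ p) (inside ∷ q) q⊆p with q⊆p Vec.here
... | ()
∣p─q∣+∣q∣≡∣p∣ (inside ∷ p) (outside ∷ q) q⊆p = cong suc (∣p─q∣+∣q∣≡∣p∣ p q (drop-there ∘ q⊆p ∘ Vec.there))
∣p─q∣+∣q∣≡∣p∣ (outside ∷ p) (outside ∷ q) q⊆p = ∣p─q∣+∣q∣≡∣p∣ p q (drop-there ∘ q⊆p ∘ Vec.there)

∣p∪q∣≡∣p∣+∣q∣ : ∀ (p q : Subset n) → Disjoint p q → ∣ p ∪ q ∣ ≡ ∣ p ∣ + ∣ q ∣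
∣p∪q∣≡∣p∣+∣q∣ [] [] _ = refl
∣p∪q∣≡∣p∣+∣q∣ (inside ∷ p) (inside ∷ q) p∩q≡∅ = ⊥-elim (p∩q≡∅ zero Vec.here Vec.here)
∣p∪q∣≡∣p∣+∣q∣ (inside ∷ p) (outside ∷ q) p∩q≡∅ =
  cong suc (∣p∪q∣≡∣p∣+∣q∣ p q (λ x x∈p x∈q → p∩q≡∅ (suc x) (Vec.there x∈p) (Vec.there x∈q)))
∣p∪q∣≡∣p∣+∣q∣ (outside ∷ p) (inside ∷ q) p∩q≡∅ =
  trans (cong suc (∣p∪q∣≡∣p∣+∣q∣ p q (λ x x∈p x∈q → p∩q≡∅ (suc x) (Vec.there x∈p) (Vec.there x∈q))))
        (sym (+-suc ∣ p ∣ ∣ q ∣))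
∣p∪q∣≡∣p∣+∣q∣ (outside ∷ p) (outside ∷ q) p∩q≡∅ =
  ∣p∪q∣≡∣p∣+∣q∣ p q (λ x x∈p x∈q → p∩q≡∅ (suc x) (Vec.there x∈p) (Vec.there x∈q))

⊆∧∣∣≤⇒⊇ : q ⊆ p → ∣ p ∣ ≤ ∣ q ∣ → p ⊆ q
⊆∧∣∣≤⇒⊇ {q = q} q⊆p ∣p∣≤∣q∣ {x} x∈p with x ∈? q
... | yes x∈q = x∈q
... | no x∉q = ⊥-elim (<-irrefl refl (≤-trans (p⊂q⇒∣p∣<∣q∣ (q⊆p , x , x∈p , x∉q)) ∣p∣≤∣q∣))

⊆-∪-by-size : q ⊆ p → r ⊆ p → Disjoint q r → ∣ p ∣ ≡ ∣ q ∣ + ∣ r ∣ → p ⊆ q ∪ r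
⊆-∪-by-size {q = q} {p = p} {r = r} q⊆p r⊆p q∩r≡∅ ∣p∣≡ =
  ⊆∧∣∣≤⇒⊇ q∪r⊆p (≤-reflexive (trans ∣p∣≡ (sym (∣p∪q∣≡∣p∣+∣q∣ q r q∩r≡∅))))
  where
  q∪r⊆p : q ∪ r ⊆ p
  q∪r⊆p x∈q∪r with ∪⁻ x∈q∪r
  ... | inj₁ x∈q = q⊆p x∈q
  ... | inj₂ x∈r = r⊆p x∈r

∣q∣<∣p∣⇒∃∈p∉q : ∣ q ∣ < ∣ p ∣ → Σ[ x ∈ Fin n ] (x ∈ p × x ∉ q)
∣q∣<∣p∣⇒∃∈p∉q {q = q} {p = p} ∣q∣<∣p∣ with nonempty? (p ─ q)
... | yes (x , x∈p─q) = x , p─q⊆p p q x∈p─q , x∈p─q⇒x∉q x∈p─q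
... | no p─q≡∅ = ⊥-elim (<-irrefl refl (≤-trans ∣q∣<∣p∣ (p⊆q⇒∣p∣≤∣q∣ p⊆q)))
  where
  p⊆q : p ⊆ q
  p⊆q {x} x∈p with x ∈? q
  ... | yes x∈q = x∈q
  ... | no x∉q = ⊥-elim (p─q≡∅ (x , x∈p∧x∉q⇒x∈p─q x∈p x∉q))

opaque
  image₃ : ∀ {R : Fin n → Fin n → Set} → ∣ p ∣ ≡ 3 →
           (∀ {x} → x ∈ p → Σ[ y ∈ Fin n ] R x y) →
           (∀ {x x' y} → x ∈ p → x' ∈ p → R x y → R x' y → x ≡ x') →
           Σ[ ys ∈ List (Fin n) ] (length ys ≡ 3 × Unique ys × All (λ y → Σ[ x ∈ Fin n ] (x ∈ p × R x y)) ys)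
  image₃ {p = p} {R = R} ∣p∣≡3 f injective with three-points ∣p∣≡3
  ... | a , b , c , ((a≢b ∷ a≢c ∷ []) ∷ (b≢c ∷ []) ∷ [] ∷ []) , a∈p ∷ b∈p ∷ c∈p ∷ [] =
    proj₁ (f a∈p) ∷ proj₁ (f b∈p) ∷ proj₁ (f c∈p) ∷ [] , refl ,
    ((separate a∈p b∈p a≢b ∷ separate a∈p c∈p a≢c ∷ []) ∷ (separate b∈p c∈p b≢c ∷ []) ∷ [] ∷ []) ,
    (a , a∈p , proj₂ (f a∈p)) ∷ (b , b∈p , proj₂ (f b∈p)) ∷ (c , c∈p , proj₂ (f c∈p)) ∷ []
    where
    separate : ∀ {x x'} (x∈p : x ∈ p) (x'∈p : x' ∈ p) → x ≢ x' → proj₁ (f x∈p) ≢ proj₁ (f x'∈p)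
    separate x∈p x'∈p x≢x' fx≡fx' =
      x≢x' (injective x∈p x'∈p (proj₂ (f x∈p)) (subst (R _) (sym fx≡fx') (proj₂ (f x'∈p))))

opaque
  onto₃ : ∀ {R : Fin n → Fin n → Set} → ∣ p ∣ ≡ 3 → ∣ q ∣ ≡ 3 →
          (∀ {x} → x ∈ p → Σ[ y ∈ Fin n ] (y ∈ q × R x y)) →
          (∀ {x x' y} → x ∈ p → x' ∈ p → y ∈ q → R x y → R x' y → x ≡ x') →
          y ∈ q → Σ[ x ∈ Fin n ] (x ∈ p × R x y)
  onto₃ ∣p∣≡3 ∣q∣≡3 f injective y∈q
    with image₃ ∣p∣≡3 f (λ x∈p x'∈p (y∈q , Rxy) (_ , Rx'y) → injective x∈p x'∈p y∈q Rxy Rx'y)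
  ... | ys , ∣ys∣≡3 , ys! , ys-images =
    let ys⊆q = All.map (proj₁ ∘ proj₂ ∘ proj₂) ys-images
        x , x∈p , _ , Rxy = All.lookup ys-images (∣p∣≡length⇒⊆ ys! ys⊆q (trans ∣q∣≡3 (sym ∣ys∣≡3)) y∈q)
    in x , x∈p , Rxy

Meets : Subset n → Subset n → Set
Meets T G = Nonempty (T ∩ G)

meets? : ∀ (G : Subset n) → Decidable (λ T → Meets T G)
meets? G T = nonempty? (T ∩ G)

_∈ᶠ?_ : ∀ (X : Subset n) F → Dec (X ∈ᶠ F)
X ∈ᶠ? F = F X ≟ᵇ true

opaque
  familyOf : {P : Subset n → Set} → Decidable P → Family n
  familyOf P? X = ⌊ P? X ⌋

opaque
  unfolding familyOf

  ∈familyOf⁺ : ∀ {P : Subset n → Set} (P? : Decidable P) {X} → P X → X ∈ᶠ familyOf P?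
  ∈familyOf⁺ P? {X} = Equivalence.to T-≡ ∘ fromWitness {a? = P? X}

  ∈familyOf⁻ : ∀ {P : Subset n → Set} (P? : Decidable P) {X} → X ∈ᶠ familyOf P? → P X
  ∈familyOf⁻ P? {X} = toWitness {a? = P? X} ∘ Equivalence.from T-≡

Joined : Family n → Fin n → Fin n → Set
Joined F x y = Σ[ T ∈ Subset _ ] (T ∈ᶠ F × x ∈ T × y ∈ T)

Joined-sym : ∀ {F : Family n} → Joined F x y → Joined F y x
Joined-sym (T , T∈F , x∈T , y∈T) = T , T∈F , y∈T , x∈T

ExactlyOneBlock-sym : ∀ {F : Family n} → ExactlyOneBlock F x y → ExactlyOneBlock F y x
ExactlyOneBlock-sym (T , T∈F , x∈T , y∈T , unique) = T , T∈F , y∈T , x∈T , λ U U∈F y∈U x∈U → unique U U∈F x∈U y∈U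

Petal : Family n → Subset n → Subset n → Set
Petal 𝓑 P D = HasSubSTS9 𝓑 (P ∪ D) ⊎ HasAlmostSubSTS9 𝓑 (P ∪ D) D

-- Steiner triple systems

module SteinerTripleSystem {𝓑 : Family n} (sts : IsSTS ⊤ 𝓑) where

  block-size : ∀ {T} → T ∈ᶠ 𝓑 → ∣ T ∣ ≡ 3
  block-size {T} T∈𝓑 = proj₁ (proj₁ sts T T∈𝓑)

  pair-block : x ≢ y → Joined 𝓑 x y
  pair-block {x = x} {y = y} x≢y with proj₂ sts x y ∈⊤ ∈⊤ x≢y
  ... | T , T∈𝓑 , x∈T , y∈T , _ = T , T∈𝓑 , x∈T , y∈T

  block-unique : ∀ {T U} → T ∈ᶠ 𝓑 → U ∈ᶠ 𝓑 → x ∈ T → y ∈ T → x ∈ U → y ∈ U → x ≢ y → T ≡ U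
  block-unique {x = x} {y = y} T∈𝓑 U∈𝓑 x∈T y∈T x∈U y∈U x≢y with proj₂ sts x y ∈⊤ ∈⊤ x≢y
  ... | _ , _ , _ , _ , unique = trans (unique _ T∈𝓑 x∈T y∈T) (sym (unique _ U∈𝓑 x∈U y∈U))

  Joined⇒ExactlyOneBlock : ∀ {F} → F ⊆ᶠ 𝓑 → x ≢ y → Joined F x y → ExactlyOneBlock F x y
  Joined⇒ExactlyOneBlock F⊆𝓑 x≢y (T , T∈F , x∈T , y∈T) =
    T , T∈F , x∈T , y∈T , λ U U∈F x∈U y∈U → block-unique (F⊆𝓑 U U∈F) (F⊆𝓑 T T∈F) x∈U y∈U x∈T y∈T x≢y

  block⊆sub-STS : ∀ {Q D T} {𝓒 : Family n} → IsSTS Q 𝓒 → (∀ X → X ∈ᶠ 𝓒 → X ≢ D → X ∈ᶠ 𝓑) →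
                  T ∈ᶠ 𝓑 → x ∈ T → y ∈ T → x ≢ y → x ∈ Q → y ∈ Q → x ∉ D → T ⊆ Q
  block⊆sub-STS {x = x} {y = y} {D = D} (𝓒⊆Q , pairs) 𝓒-D⊆𝓑 T∈𝓑 x∈T y∈T x≢y x∈Q y∈Q x∉D
    with pairs x y x∈Q y∈Q x≢y
  ... | X , X∈𝓒 , x∈X , y∈X , _ =
    subst (_⊆ _) (block-unique X∈𝓑 T∈𝓑 x∈X y∈X x∈T y∈T x≢y) (proj₂ (𝓒⊆Q X X∈𝓒))
    where
    X∈𝓑 : X ∈ᶠ 𝓑
    X∈𝓑 = 𝓒-D⊆𝓑 X X∈𝓒 (λ X≡D → x∉D (subst (x ∈_) X≡D x∈X))

  petal-closed : ∀ {P D T} → Disjoint P D → Petal 𝓑 P D →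
                 T ∈ᶠ 𝓑 → x ∈ T → y ∈ T → x ≢ y → x ∈ P → y ∈ P ∪ D → T ⊆ P ∪ D
  petal-closed P∩D≡∅ (inj₁ (_ , 𝓒 , 𝓒⊆𝓑 , 𝓒-STS)) T∈𝓑 x∈T y∈T x≢y x∈P y∈P∪D =
    block⊆sub-STS 𝓒-STS (λ X X∈𝓒 _ → 𝓒⊆𝓑 X X∈𝓒) T∈𝓑 x∈T y∈T x≢y (∪⁺ˡ x∈P) y∈P∪D (P∩D≡∅ _ x∈P)
  petal-closed P∩D≡∅ (inj₂ (_ , 𝓒 , 𝓒-STS , _ , 𝓒-D⊆𝓑)) T∈𝓑 x∈T y∈T x≢y x∈P y∈P∪D =
    block⊆sub-STS 𝓒-STS 𝓒-D⊆𝓑 T∈𝓑 x∈T y∈T x≢y (∪⁺ˡ x∈P) y∈P∪D (P∩D≡∅ _ x∈P)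

  halves : ∀ {P P₀ P₁} → ∣ P ∣ ≡ 6 → P₀ ∈ᶠ 𝓑 → P₁ ∈ᶠ 𝓑 → P₀ ⊆ P → P₁ ⊆ P → Disjoint P₀ P₁ → P ⊆ P₀ ∪ P₁
  halves ∣P∣≡6 P₀∈𝓑 P₁∈𝓑 P₀⊆P P₁⊆P P₀∩P₁≡∅ =
    ⊆-∪-by-size P₀⊆P P₁⊆P P₀∩P₁≡∅ (trans ∣P∣≡6 (sym (cong₂ _+_ (block-size P₀∈𝓑) (block-size P₁∈𝓑))))

  module SplitPetal {P P₀ P₁ D : Subset n} (P∩D≡∅ : Disjoint P D) (petal : Petal 𝓑 P D) (∣D∣≡3 : ∣ D ∣ ≡ 3)
                    (∣P∣≡6 : ∣ P ∣ ≡ 6) (P₀∈𝓑 : P₀ ∈ᶠ 𝓑) (P₁∈𝓑 : P₁ ∈ᶠ 𝓑) (P₀⊆P : P₀ ⊆ P) (P₁⊆P : P₁ ⊆ P)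
                    (P₀∩P₁≡∅ : Disjoint P₀ P₁) where

    P⊆P₀∪P₁ : P ⊆ P₀ ∪ P₁
    P⊆P₀∪P₁ = halves ∣P∣≡6 P₀∈𝓑 P₁∈𝓑 P₀⊆P P₁⊆P P₀∩P₁≡∅

    opaque
      cross-block-meets-stem : x ∈ P₀ → y ∈ P₁ → Σ[ T ∈ Subset n ] (T ∈ᶠ 𝓑 × x ∈ T × y ∈ T × Meets T D)
      cross-block-meets-stem {x = x} {y = y} x∈P₀ y∈P₁ = meets-stem (pair-block x≢y)
        where
        x≢y : x ≢ y
        x≢y = Disjoint⇒≢ P₀∩P₁≡∅ x∈P₀ y∈P₁
        meets-stem : Joined 𝓑 x y → Σ[ T ∈ Subset n ] (T ∈ᶠ 𝓑 × x ∈ T × y ∈ T × Meets T D)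
        meets-stem (T , T∈𝓑 , x∈T , y∈T) with third-point (block-size T∈𝓑) x y
        ... | z , z∈T , z≢x , z≢y with ∪⁻ (petal-closed P∩D≡∅ petal T∈𝓑 x∈T y∈T x≢y (P₀⊆P x∈P₀) (∪⁺ˡ (P₁⊆P y∈P₁)) z∈T)
        ... | inj₂ z∈D = T , T∈𝓑 , x∈T , y∈T , z , ∩⁺ z∈T z∈D
        ... | inj₁ z∈P with ∪⁻ (P⊆P₀∪P₁ z∈P)
        ... | inj₁ z∈P₀ =
          ⊥-elim (P₀∩P₁≡∅ y (subst (y ∈_) (block-unique T∈𝓑 P₀∈𝓑 x∈T z∈T x∈P₀ z∈P₀ (z≢x ∘ sym)) y∈T) y∈P₁)
        ... | inj₂ z∈P₁ =
          ⊥-elim (P₀∩P₁≡∅ x x∈P₀ (subst (x ∈_) (block-unique T∈𝓑 P₁∈𝓑 y∈T z∈T y∈P₁ z∈P₁ (z≢y ∘ sym)) x∈T))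

    opaque
      -- The blocks through x and the three points of P₁ meet D in three distinct points, one of them d.
      stem-joins : ∀ {d} → d ∈ D → x ∈ P₀ → Σ[ T ∈ Subset n ] (T ∈ᶠ 𝓑 × d ∈ T × x ∈ T × Meets T P₁)
      stem-joins {x = x} {d} d∈D x∈P₀ = joins (onto₃ (block-size P₁∈𝓑) ∣D∣≡3 stem-point injective d∈D)
        where
        Through : Fin n → Fin n → Set
        Through y d = Σ[ T ∈ Subset n ] (T ∈ᶠ 𝓑 × x ∈ T × y ∈ T × d ∈ T)
        stem-point : y ∈ P₁ → Σ[ d ∈ Fin n ] (d ∈ D × Through y d)
        stem-point y∈P₁ with cross-block-meets-stem x∈P₀ y∈P₁
        ... | T , T∈𝓑 , x∈T , y∈T , d , d∈T∩D = d , ∩⁻ʳ d∈T∩D , T , T∈𝓑 , x∈T , y∈T , ∩⁻ˡ d∈T∩D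
        injective : ∀ {y y' d} → y ∈ P₁ → y' ∈ P₁ → d ∈ D → Through y d → Through y' d → y ≡ y'
        injective {y} {y'} y∈P₁ y'∈P₁ d∈D (T , T∈𝓑 , x∈T , y∈T , d∈T) (U , U∈𝓑 , x∈U , y'∈U , d∈U) with y ≟ y'
        ... | yes y≡y' = y≡y'
        ... | no y≢y' = ⊥-elim (P₀∩P₁≡∅ x x∈P₀ (subst (x ∈_) T≡P₁ x∈T))
          where
          T≡P₁ : T ≡ P₁
          T≡P₁ = block-unique T∈𝓑 P₁∈𝓑 y∈T (subst (y' ∈_) (sym (block-unique T∈𝓑 U∈𝓑 x∈T d∈T x∈U d∈U
                   (Disjoint⇒≢ P∩D≡∅ (P₀⊆P x∈P₀) d∈D))) y'∈U) y∈P₁ y'∈P₁ y≢y'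
        joins : Σ[ y ∈ Fin n ] (y ∈ P₁ × Through y d) → Σ[ T ∈ Subset n ] (T ∈ᶠ 𝓑 × d ∈ T × x ∈ T × Meets T P₁)
        joins (y , y∈P₁ , T , T∈𝓑 , x∈T , y∈T , d∈T) = T , T∈𝓑 , d∈T , x∈T , y , ∩⁺ y∈T y∈P₁

-- Transversal designs

module TransversalDesign {w} {X Y Z : Subset n} {F : Family n} (td : IsTD w X Y Z F) where

  X∩Y≡∅ : Disjoint X Y
  X∩Y≡∅ = proj₁ (proj₂ (proj₂ (proj₂ td)))

  X∩Z≡∅ : Disjoint X Z
  X∩Z≡∅ = proj₁ (proj₂ (proj₂ (proj₂ (proj₂ td))))

  Y∩Z≡∅ : Disjoint Y Z
  Y∩Z≡∅ = proj₁ (proj₂ (proj₂ (proj₂ (proj₂ (proj₂ td)))))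

  private
    blocks : ∀ T → T ∈ᶠ F → ∣ T ∣ ≡ 3 × ∣ T ∩ X ∣ ≡ 1 × ∣ T ∩ Y ∣ ≡ 1 × ∣ T ∩ Z ∣ ≡ 1
    blocks = proj₁ (proj₂ (proj₂ (proj₂ (proj₂ (proj₂ (proj₂ td))))))

    pairs : ∀ x y → (x ∈ X × y ∈ Y) ⊎ (x ∈ X × y ∈ Z) ⊎ (x ∈ Y × y ∈ Z) → ExactlyOneBlock F x y
    pairs = proj₂ (proj₂ (proj₂ (proj₂ (proj₂ (proj₂ (proj₂ td))))))

  Group : Subset n → Set
  Group G = G ≡ X ⊎ G ≡ Y ⊎ G ≡ Z

  group-size : ∀ {G} → Group G → ∣ G ∣ ≡ w
  group-size (inj₁ refl) = proj₁ td
  group-size (inj₂ (inj₁ refl)) = proj₁ (proj₂ td)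
  group-size (inj₂ (inj₂ refl)) = proj₁ (proj₂ (proj₂ td))

  block-size : ∀ {T} → T ∈ᶠ F → ∣ T ∣ ≡ 3
  block-size {T} T∈F = proj₁ (blocks T T∈F)

  ∣block∩group∣≡1 : ∀ {G T} → Group G → T ∈ᶠ F → ∣ T ∩ G ∣ ≡ 1
  ∣block∩group∣≡1 {T = T} (inj₁ refl) T∈F = proj₁ (proj₂ (blocks T T∈F))
  ∣block∩group∣≡1 {T = T} (inj₂ (inj₁ refl)) T∈F = proj₁ (proj₂ (proj₂ (blocks T T∈F)))
  ∣block∩group∣≡1 {T = T} (inj₂ (inj₂ refl)) T∈F = proj₂ (proj₂ (proj₂ (blocks T T∈F)))

  one-point-per-group : ∀ {G T} → Group G → T ∈ᶠ F → x ∈ T → y ∈ T → x ∈ G → y ∈ G → x ≡ y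
  one-point-per-group G-group T∈F x∈T y∈T x∈G y∈G =
    ∣p∣≡1⇒≡ (∣block∩group∣≡1 G-group T∈F) (∩⁺ x∈T x∈G) (∩⁺ y∈T y∈G)

  ∣block∩subgroup∣≡1 : ∀ {G H T} → Group G → H ⊆ G → T ∈ᶠ F → Meets T H → ∣ T ∩ H ∣ ≡ 1
  ∣block∩subgroup∣≡1 G-group H⊆G T∈F (x , x∈T∩H) = ∣p∣≡1 x∈T∩H λ y∈T∩H →
    one-point-per-group G-group T∈F (∩⁻ˡ y∈T∩H) (∩⁻ˡ x∈T∩H) (H⊆G (∩⁻ʳ y∈T∩H)) (H⊆G (∩⁻ʳ x∈T∩H))

  meets-one-of : ∀ {G H H' T} → Group G → H ⊆ G → H' ⊆ G → Disjoint H H' → T ∈ᶠ F →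
                 Meets T H → Meets T H' → ⊥
  meets-one-of G-group H⊆G H'⊆G H∩H'≡∅ T∈F (x , x∈T∩H) (y , y∈T∩H') =
    H∩H'≡∅ y (subst (_∈ _) (one-point-per-group G-group T∈F (∩⁻ˡ x∈T∩H) (∩⁻ˡ y∈T∩H')
                               (H⊆G (∩⁻ʳ x∈T∩H)) (H'⊆G (∩⁻ʳ y∈T∩H'))) (∩⁻ʳ x∈T∩H)) (∩⁻ʳ y∈T∩H')

  group-unique : ∀ {G H} → Group G → Group H → x ∈ G → x ∈ H → G ≡ H
  group-unique (inj₁ refl) (inj₁ refl) _ _ = refl
  group-unique (inj₁ refl) (inj₂ (inj₁ refl)) x∈X x∈Y = ⊥-elim (X∩Y≡∅ _ x∈X x∈Y)
  group-unique (inj₁ refl) (inj₂ (inj₂ refl)) x∈X x∈Z = ⊥-elim (X∩Z≡∅ _ x∈X x∈Z)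
  group-unique (inj₂ (inj₁ refl)) (inj₁ refl) x∈Y x∈X = ⊥-elim (X∩Y≡∅ _ x∈X x∈Y)
  group-unique (inj₂ (inj₁ refl)) (inj₂ (inj₁ refl)) _ _ = refl
  group-unique (inj₂ (inj₁ refl)) (inj₂ (inj₂ refl)) x∈Y x∈Z = ⊥-elim (Y∩Z≡∅ _ x∈Y x∈Z)
  group-unique (inj₂ (inj₂ refl)) (inj₁ refl) x∈Z x∈X = ⊥-elim (X∩Z≡∅ _ x∈X x∈Z)
  group-unique (inj₂ (inj₂ refl)) (inj₂ (inj₁ refl)) x∈Z x∈Y = ⊥-elim (Y∩Z≡∅ _ x∈Y x∈Z)
  group-unique (inj₂ (inj₂ refl)) (inj₂ (inj₂ refl)) _ _ = refl

  pair-across : ∀ {G H} → Group G → Group H → x ∈ G → y ∈ H → y ∉ G → ExactlyOneBlock F x y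
  pair-across (inj₁ refl) (inj₁ refl) _ y∈X y∉X = ⊥-elim (y∉X y∈X)
  pair-across (inj₁ refl) (inj₂ (inj₁ refl)) x∈X y∈Y _ = pairs _ _ (inj₁ (x∈X , y∈Y))
  pair-across (inj₁ refl) (inj₂ (inj₂ refl)) x∈X y∈Z _ = pairs _ _ (inj₂ (inj₁ (x∈X , y∈Z)))
  pair-across (inj₂ (inj₁ refl)) (inj₁ refl) x∈Y y∈X _ = ExactlyOneBlock-sym (pairs _ _ (inj₁ (y∈X , x∈Y)))
  pair-across (inj₂ (inj₁ refl)) (inj₂ (inj₁ refl)) _ y∈Y y∉Y = ⊥-elim (y∉Y y∈Y)
  pair-across (inj₂ (inj₁ refl)) (inj₂ (inj₂ refl)) x∈Y y∈Z _ = pairs _ _ (inj₂ (inj₂ (x∈Y , y∈Z)))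
  pair-across (inj₂ (inj₂ refl)) (inj₁ refl) x∈Z y∈X _ =
    ExactlyOneBlock-sym (pairs _ _ (inj₂ (inj₁ (y∈X , x∈Z))))
  pair-across (inj₂ (inj₂ refl)) (inj₂ (inj₁ refl)) x∈Z y∈Y _ =
    ExactlyOneBlock-sym (pairs _ _ (inj₂ (inj₂ (y∈Y , x∈Z))))
  pair-across (inj₂ (inj₂ refl)) (inj₂ (inj₂ refl)) _ y∈Z y∉Z = ⊥-elim (y∉Z y∈Z)

  opaque
    block-points : ∀ {T} → T ∈ᶠ F → Σ[ a ∈ Fin n ] Σ[ b ∈ Fin n ] Σ[ c ∈ Fin n ]
                     (a ∈ T ∩ X × b ∈ T ∩ Y × c ∈ T ∩ Z × (∀ {y} → y ∈ T → y ∈ₗ a ∷ b ∷ c ∷ []))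
    block-points {T} T∈F with blocks T T∈F
    ... | ∣T∣≡3 , ∣T∩X∣≡1 , ∣T∩Y∣≡1 , ∣T∩Z∣≡1
      with ∣p∣≡1+k⇒nonempty ∣T∩X∣≡1 | ∣p∣≡1+k⇒nonempty ∣T∩Y∣≡1 | ∣p∣≡1+k⇒nonempty ∣T∩Z∣≡1
    ... | a , a∈ | b , b∈ | c , c∈ =
      a , b , c , a∈ , b∈ , c∈ ,
      ∣p∣≡length⇒⊆ ( (Disjoint⇒≢ X∩Y≡∅ (∩⁻ʳ a∈) (∩⁻ʳ b∈) ∷ Disjoint⇒≢ X∩Z≡∅ (∩⁻ʳ a∈) (∩⁻ʳ c∈) ∷ [])
                   ∷ (Disjoint⇒≢ Y∩Z≡∅ (∩⁻ʳ b∈) (∩⁻ʳ c∈) ∷ []) ∷ [] ∷ [])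
                   (∩⁻ˡ a∈ ∷ ∩⁻ˡ b∈ ∷ ∩⁻ˡ c∈ ∷ []) ∣T∣≡3

  block⊆support : ∀ {T} → T ∈ᶠ F → T ⊆ X ∪ Y ∪ Z
  block⊆support T∈F y∈T with block-points T∈F
  ... | _ , _ , _ , a∈ , b∈ , c∈ , T⊆abc with T⊆abc y∈T
  ... | here refl = ∪⁺ˡ (∩⁻ʳ a∈)
  ... | there (here refl) = ∪⁺ʳ (∪⁺ˡ (∩⁻ʳ b∈))
  ... | there (there (here refl)) = ∪⁺ʳ (∪⁺ʳ (∩⁻ʳ c∈))

determined-by-two : ∀ {ℓ} {P₁ P₁' P₂ P₂' P₃ P₃' : Set ℓ} → P₁ ⊎ P₁' → P₂ ⊎ P₂' → (P₃ → ¬ P₃') →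
                    (P₁ → P₂ → P₃) → (P₁ → P₂' → P₃') → (P₁' → P₂ → P₃') →
                    (P₁ × P₂) ⊎ (P₁ × P₃) ⊎ (P₂ × P₃) → P₁ × P₂ × P₃
determined-by-two _ _ _ law _ _ (inj₁ (p₁ , p₂)) = p₁ , p₂ , law p₁ p₂
determined-by-two _ (inj₁ p₂) _ _ _ _ (inj₂ (inj₁ (p₁ , p₃))) = p₁ , p₂ , p₃
determined-by-two _ (inj₂ p₂') disj _ law₂₃ _ (inj₂ (inj₁ (p₁ , p₃))) = ⊥-elim (disj p₃ (law₂₃ p₁ p₂'))
determined-by-two (inj₁ p₁) _ _ _ _ _ (inj₂ (inj₂ (p₂ , p₃))) = p₁ , p₂ , p₃
determined-by-two (inj₂ p₁') _ disj _ _ law₁₃ (inj₂ (inj₂ (p₂ , p₃))) = ⊥-elim (disj p₃ (law₁₃ p₁' p₂))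

-- The flower

module Flower
  {𝓑 : Family 21} {A B C D D' : Subset 21} {𝓣 : Family 21}
  (sts : IsSTS ⊤ 𝓑)
  (A∩D≡∅ : Disjoint A D) (B∩D≡∅ : Disjoint B D) (C∩D≡∅ : Disjoint C D)
  (covering : ∀ x → x ∈ A ⊎ x ∈ B ⊎ x ∈ C ⊎ x ∈ D)
  (∣D∣≡3 : ∣ D ∣ ≡ 3) (petal-B : Petal 𝓑 B D) (petal-C : Petal 𝓑 C D)
  (𝓣⊆𝓑 : 𝓣 ⊆ᶠ 𝓑) (𝓣-TD : IsTD 6 A B C 𝓣)
  (∣D'∣≡3 : ∣ D' ∣ ≡ 3) (D'⊆A : D' ⊆ A)
  where

  open SteinerTripleSystem sts
  module 𝓣 = TransversalDesign 𝓣-TD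
  open 𝓣 using () renaming (X∩Y≡∅ to A∩B≡∅; X∩Z≡∅ to A∩C≡∅; Y∩Z≡∅ to B∩C≡∅)

  A-group : 𝓣.Group A
  A-group = inj₁ refl

  B-group : 𝓣.Group B
  B-group = inj₂ (inj₁ refl)

  C-group : 𝓣.Group C
  C-group = inj₂ (inj₂ refl)

  record Line (T : Subset 21) (a b c : Fin 21) : Set where
    constructor line
    field
      T∈𝓣 : T ∈ᶠ 𝓣
      a∈T : a ∈ T
      b∈T : b ∈ T
      c∈T : c ∈ T
      a∈A : a ∈ A
      b∈B : b ∈ B
      c∈C : c ∈ C

  opaque
    line-of : ∀ {T} → T ∈ᶠ 𝓣 → Σ[ a ∈ Fin 21 ] Σ[ b ∈ Fin 21 ] Σ[ c ∈ Fin 21 ] Line T a b c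
    line-of T∈𝓣 with 𝓣.block-points T∈𝓣
    ... | a , b , c , a∈ , b∈ , c∈ , _ = a , b , c , line T∈𝓣 (∩⁻ˡ a∈) (∩⁻ˡ b∈) (∩⁻ˡ c∈) (∩⁻ʳ a∈) (∩⁻ʳ b∈) (∩⁻ʳ c∈)

  opaque
    line-AB : ∀ {a b} → a ∈ A → b ∈ B → Σ[ T ∈ Subset 21 ] Σ[ c ∈ Fin 21 ] Line T a b c
    line-AB a∈A b∈B with 𝓣.pair-across A-group B-group a∈A b∈B (λ b∈A → A∩B≡∅ _ b∈A b∈B)
    ... | T , T∈𝓣 , a∈T , b∈T , _ with 𝓣.block-points T∈𝓣
    ... | _ , _ , c , _ , _ , c∈ , _ = T , c , line T∈𝓣 a∈T b∈T (∩⁻ˡ c∈) a∈A b∈B (∩⁻ʳ c∈)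

    line-AC : ∀ {a c} → a ∈ A → c ∈ C → Σ[ T ∈ Subset 21 ] Σ[ b ∈ Fin 21 ] Line T a b c
    line-AC a∈A c∈C with 𝓣.pair-across A-group C-group a∈A c∈C (λ c∈A → A∩C≡∅ _ c∈A c∈C)
    ... | T , T∈𝓣 , a∈T , c∈T , _ with 𝓣.block-points T∈𝓣
    ... | _ , b , _ , _ , b∈ , _ = T , b , line T∈𝓣 a∈T (∩⁻ˡ b∈) c∈T a∈A (∩⁻ʳ b∈) c∈C

    line-BC : ∀ {b c} → b ∈ B → c ∈ C → Σ[ T ∈ Subset 21 ] Σ[ a ∈ Fin 21 ] Line T a b c
    line-BC b∈B c∈C with 𝓣.pair-across B-group C-group b∈B c∈C (λ c∈B → B∩C≡∅ _ c∈B c∈C)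
    ... | T , T∈𝓣 , b∈T , c∈T , _ with 𝓣.block-points T∈𝓣
    ... | a , _ , _ , a∈ , _ = T , a , line T∈𝓣 (∩⁻ˡ a∈) b∈T c∈T (∩⁻ʳ a∈) b∈B c∈C

  line-unique-A : ∀ {T U a a' b c} → Line T a b c → Line U a' b c → a ≡ a'
  line-unique-A {T} {U} (line T∈𝓣 a∈T b∈T c∈T a∈A b∈B c∈C) (line U∈𝓣 a'∈U b∈U c∈U a'∈A _ _) =
    𝓣.one-point-per-group A-group T∈𝓣 a∈T (subst (_ ∈_) (sym T≡U) a'∈U) a∈A a'∈A
    where
    T≡U : T ≡ U
    T≡U = block-unique (𝓣⊆𝓑 _ T∈𝓣) (𝓣⊆𝓑 _ U∈𝓣) b∈T c∈T b∈U c∈U (Disjoint⇒≢ B∩C≡∅ b∈B c∈C)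

  line-meets-A : ∀ {T a b c G} → Line T a b c → G ⊆ A → Meets T G → a ∈ G
  line-meets-A (line T∈𝓣 a∈T _ _ a∈A _ _) G⊆A (x , x∈T∩G) =
    subst (_∈ _) (𝓣.one-point-per-group A-group T∈𝓣 (∩⁻ˡ x∈T∩G) a∈T (G⊆A (∩⁻ʳ x∈T∩G)) a∈A) (∩⁻ʳ x∈T∩G)

  line-meets-B : ∀ {T a b c G} → Line T a b c → G ⊆ B → Meets T G → b ∈ G
  line-meets-B (line T∈𝓣 _ b∈T _ _ b∈B _) G⊆B (x , x∈T∩G) =
    subst (_∈ _) (𝓣.one-point-per-group B-group T∈𝓣 (∩⁻ˡ x∈T∩G) b∈T (G⊆B (∩⁻ʳ x∈T∩G)) b∈B) (∩⁻ʳ x∈T∩G)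

  line-meets-C : ∀ {T a b c G} → Line T a b c → G ⊆ C → Meets T G → c ∈ G
  line-meets-C (line T∈𝓣 _ _ c∈T _ _ c∈C) G⊆C (x , x∈T∩G) =
    subst (_∈ _) (𝓣.one-point-per-group C-group T∈𝓣 (∩⁻ˡ x∈T∩G) c∈T (G⊆C (∩⁻ʳ x∈T∩G)) c∈C) (∩⁻ʳ x∈T∩G)

  Closed : Subset 21 → Subset 21 → Subset 21 → Set
  Closed G₁ G₂ G₃ = ∀ {T a b c} → Line T a b c →
    (a ∈ G₁ × b ∈ G₂) ⊎ (a ∈ G₁ × c ∈ G₃) ⊎ (b ∈ G₂ × c ∈ G₃) → a ∈ G₁ × b ∈ G₂ × c ∈ G₃

  InPart : Subset 21 → Subset 21 → Subset 21 → Subset 21 → Set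
  InPart G₁ G₂ G₃ T = T ∈ᶠ 𝓣 × Meets T G₁ × Meets T G₂ × Meets T G₃

  in-part? : ∀ G₁ G₂ G₃ → Decidable (InPart G₁ G₂ G₃)
  in-part? G₁ G₂ G₃ T = (T ∈ᶠ? 𝓣) ×-dec meets? G₁ T ×-dec meets? G₂ T ×-dec meets? G₃ T

  part : Subset 21 → Subset 21 → Subset 21 → Family 21
  part G₁ G₂ G₃ = familyOf (in-part? G₁ G₂ G₃)

  module _ {G₁ G₂ G₃ T : Subset 21} where

    ∈part⁺ : InPart G₁ G₂ G₃ T → T ∈ᶠ part G₁ G₂ G₃
    ∈part⁺ = ∈familyOf⁺ (in-part? G₁ G₂ G₃)

    ∈part⁻ : T ∈ᶠ part G₁ G₂ G₃ → InPart G₁ G₂ G₃ T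
    ∈part⁻ = ∈familyOf⁻ (in-part? G₁ G₂ G₃)

  part⊆𝓣 : ∀ {G₁ G₂ G₃} → part G₁ G₂ G₃ ⊆ᶠ 𝓣
  part⊆𝓣 T T∈part = proj₁ (∈part⁻ T∈part)

  part⊆𝓑 : ∀ {G₁ G₂ G₃} → part G₁ G₂ G₃ ⊆ᶠ 𝓑
  part⊆𝓑 T = 𝓣⊆𝓑 T ∘ part⊆𝓣 T

  line∈part : ∀ {G₁ G₂ G₃ T a b c} → Line T a b c → a ∈ G₁ × b ∈ G₂ × c ∈ G₃ → T ∈ᶠ part G₁ G₂ G₃
  line∈part (line T∈𝓣 a∈T b∈T c∈T _ _ _) (a∈G₁ , b∈G₂ , c∈G₃) =
    ∈part⁺ (T∈𝓣 , (_ , ∩⁺ a∈T a∈G₁) , (_ , ∩⁺ b∈T b∈G₂) , (_ , ∩⁺ c∈T c∈G₃))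

  Closed⇒IsTD : ∀ {G₁ G₂ G₃} → G₁ ⊆ A → G₂ ⊆ B → G₃ ⊆ C → ∣ G₁ ∣ ≡ 3 → ∣ G₂ ∣ ≡ 3 → ∣ G₃ ∣ ≡ 3 →
                Closed G₁ G₂ G₃ → IsTD 3 G₁ G₂ G₃ (part G₁ G₂ G₃)
  Closed⇒IsTD {G₁} {G₂} {G₃} G₁⊆A G₂⊆B G₃⊆C ∣G₁∣≡3 ∣G₂∣≡3 ∣G₃∣≡3 closed =
    ∣G₁∣≡3 , ∣G₂∣≡3 , ∣G₃∣≡3 ,
    (λ x x∈G₁ x∈G₂ → A∩B≡∅ x (G₁⊆A x∈G₁) (G₂⊆B x∈G₂)) ,
    (λ x x∈G₁ x∈G₃ → A∩C≡∅ x (G₁⊆A x∈G₁) (G₃⊆C x∈G₃)) ,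
    (λ x x∈G₂ x∈G₃ → B∩C≡∅ x (G₂⊆B x∈G₂) (G₃⊆C x∈G₃)) ,
    blocks , pairs
    where
    blocks : ∀ T → T ∈ᶠ part G₁ G₂ G₃ → ∣ T ∣ ≡ 3 × ∣ T ∩ G₁ ∣ ≡ 1 × ∣ T ∩ G₂ ∣ ≡ 1 × ∣ T ∩ G₃ ∣ ≡ 1
    blocks T T∈part with ∈part⁻ T∈part
    ... | T∈𝓣 , meets₁ , meets₂ , meets₃ =
      𝓣.block-size T∈𝓣 ,
      𝓣.∣block∩subgroup∣≡1 A-group G₁⊆A T∈𝓣 meets₁ ,
      𝓣.∣block∩subgroup∣≡1 B-group G₂⊆B T∈𝓣 meets₂ ,
      𝓣.∣block∩subgroup∣≡1 C-group G₃⊆C T∈𝓣 meets₃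
    pairs : ∀ x y → (x ∈ G₁ × y ∈ G₂) ⊎ (x ∈ G₁ × y ∈ G₃) ⊎ (x ∈ G₂ × y ∈ G₃) → ExactlyOneBlock (part G₁ G₂ G₃) x y
    pairs x y (inj₁ (x∈G₁ , y∈G₂)) =
      let T , _ , ℓ = line-AB (G₁⊆A x∈G₁) (G₂⊆B y∈G₂) in
      Joined⇒ExactlyOneBlock part⊆𝓑 (Disjoint⇒≢ A∩B≡∅ (G₁⊆A x∈G₁) (G₂⊆B y∈G₂))
        (T , line∈part ℓ (closed ℓ (inj₁ (x∈G₁ , y∈G₂))) , Line.a∈T ℓ , Line.b∈T ℓ)
    pairs x y (inj₂ (inj₁ (x∈G₁ , y∈G₃))) =
      let T , _ , ℓ = line-AC (G₁⊆A x∈G₁) (G₃⊆C y∈G₃) in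
      Joined⇒ExactlyOneBlock part⊆𝓑 (Disjoint⇒≢ A∩C≡∅ (G₁⊆A x∈G₁) (G₃⊆C y∈G₃))
        (T , line∈part ℓ (closed ℓ (inj₂ (inj₁ (x∈G₁ , y∈G₃)))) , Line.a∈T ℓ , Line.c∈T ℓ)
    pairs x y (inj₂ (inj₂ (x∈G₂ , y∈G₃))) =
      let T , _ , ℓ = line-BC (G₂⊆B x∈G₂) (G₃⊆C y∈G₃) in
      Joined⇒ExactlyOneBlock part⊆𝓑 (Disjoint⇒≢ B∩C≡∅ (G₂⊆B x∈G₂) (G₃⊆C y∈G₃))
        (T , line∈part ℓ (closed ℓ (inj₂ (inj₂ (x∈G₂ , y∈G₃)))) , Line.b∈T ℓ , Line.c∈T ℓ)

  module _ {G₁ G₂ G₃ : Subset 21} {F : Family 21} (F-TD : IsTD 3 G₁ G₂ G₃ F) (F⊆𝓣 : F ⊆ᶠ 𝓣)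
           (G₁⊆A : G₁ ⊆ A) (G₂⊆B : G₂ ⊆ B) (G₃⊆C : G₃ ⊆ C) where

    private
      module F = TransversalDesign F-TD

    sub-TD-points : ∀ {T a b c} → Line T a b c → T ∈ᶠ F → a ∈ G₁ × b ∈ G₂ × c ∈ G₃
    sub-TD-points ℓ T∈F =
      let _ , _ , _ , a'∈ , b'∈ , c'∈ , _ = F.block-points T∈F
      in line-meets-A ℓ G₁⊆A (_ , a'∈) , line-meets-B ℓ G₂⊆B (_ , b'∈) , line-meets-C ℓ G₃⊆C (_ , c'∈)

    sub-TD⇒Closed : Closed G₁ G₂ G₃
    sub-TD⇒Closed {T} ℓ@(line T∈𝓣 a∈T b∈T c∈T a∈A b∈B c∈C) = sub-TD-points ℓ ∘ T∈F
      where
      through : ∀ {x y} → ExactlyOneBlock F x y → x ∈ T → y ∈ T → x ≢ y → T ∈ᶠ F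
      through (U , U∈F , x∈U , y∈U , _) x∈T y∈T x≢y =
        subst (_∈ᶠ F) (block-unique (𝓣⊆𝓑 _ (F⊆𝓣 _ U∈F)) (𝓣⊆𝓑 _ T∈𝓣) x∈U y∈U x∈T y∈T x≢y) U∈F
      T∈F : (_ ∈ G₁ × _ ∈ G₂) ⊎ (_ ∈ G₁ × _ ∈ G₃) ⊎ (_ ∈ G₂ × _ ∈ G₃) → T ∈ᶠ F
      T∈F (inj₁ (a∈G₁ , b∈G₂)) =
        through (F.pair-across (inj₁ refl) (inj₂ (inj₁ refl)) a∈G₁ b∈G₂ (λ b∈G₁ → F.X∩Y≡∅ _ b∈G₁ b∈G₂))
                a∈T b∈T (Disjoint⇒≢ A∩B≡∅ a∈A b∈B)
      T∈F (inj₂ (inj₁ (a∈G₁ , c∈G₃))) =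
        through (F.pair-across (inj₁ refl) (inj₂ (inj₂ refl)) a∈G₁ c∈G₃ (λ c∈G₁ → F.X∩Z≡∅ _ c∈G₁ c∈G₃))
                a∈T c∈T (Disjoint⇒≢ A∩C≡∅ a∈A c∈C)
      T∈F (inj₂ (inj₂ (b∈G₂ , c∈G₃))) =
        through (F.pair-across (inj₂ (inj₁ refl)) (inj₂ (inj₂ refl)) b∈G₂ c∈G₃ (λ c∈G₂ → F.Y∩Z≡∅ _ c∈G₂ c∈G₃))
                b∈T c∈T (Disjoint⇒≢ B∩C≡∅ b∈B c∈C)

  A' : Subset 21
  A' = A ─ D'

  ∣A'∣≡3 : ∣ A' ∣ ≡ 3
  ∣A'∣≡3 = begin
    ∣ A' ∣               ≡⟨ m+n∸n≡m ∣ A' ∣ 3 ⟨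
    ∣ A' ∣ + 3 ∸ 3       ≡⟨ cong (λ k → ∣ A' ∣ + k ∸ 3) ∣D'∣≡3 ⟨
    ∣ A' ∣ + ∣ D' ∣ ∸ 3  ≡⟨ cong (_∸ 3) (∣p─q∣+∣q∣≡∣p∣ A D' D'⊆A) ⟩
    ∣ A ∣ ∸ 3            ≡⟨ cong (_∸ 3) (𝓣.group-size A-group) ⟩
    3                    ∎
    where open ≡-Reasoning

  D'-or-A' : ∀ {a} → a ∈ A → a ∈ D' ⊎ a ∈ A'
  D'-or-A' {a} a∈A = map₂ (x∈p∧x∉q⇒x∈p─q a∈A) (toSum (a ∈? D'))

  B∩D'≡∅ : Disjoint B D'
  B∩D'≡∅ = Disjoint-⊆ id D'⊆A (Disjoint-sym A∩B≡∅)

  C∩D'≡∅ : Disjoint C D'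
  C∩D'≡∅ = Disjoint-⊆ id D'⊆A (Disjoint-sym A∩C≡∅)

  D∩D'≡∅ : Disjoint D D'
  D∩D'≡∅ = Disjoint-⊆ id D'⊆A (Disjoint-sym A∩D≡∅)

  𝓣-avoids-D : ∀ {T x} → T ∈ᶠ 𝓣 → x ∈ T → x ∉ D
  𝓣-avoids-D T∈𝓣 x∈T x∈D with ∪⁻ (𝓣.block⊆support T∈𝓣 x∈T)
  ... | inj₁ x∈A = A∩D≡∅ _ x∈A x∈D
  ... | inj₂ x∈B∪C with ∪⁻ x∈B∪C
  ... | inj₁ x∈B = B∩D≡∅ _ x∈B x∈D
  ... | inj₂ x∈C = C∩D≡∅ _ x∈C x∈D

  record Splitting : Set where
    field
      B₀ B₁ C₀ C₁ : Subset 21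
      B₀∈𝓑 : B₀ ∈ᶠ 𝓑
      B₁∈𝓑 : B₁ ∈ᶠ 𝓑
      C₀∈𝓑 : C₀ ∈ᶠ 𝓑
      C₁∈𝓑 : C₁ ∈ᶠ 𝓑
      B₀⊆B : B₀ ⊆ B
      B₁⊆B : B₁ ⊆ B
      C₀⊆C : C₀ ⊆ C
      C₁⊆C : C₁ ⊆ C
      B₀∩B₁≡∅ : Disjoint B₀ B₁
      C₀∩C₁≡∅ : Disjoint C₀ C₁
      D'B₀⇒C₀ : ∀ {T a b c} → Line T a b c → a ∈ D' → b ∈ B₀ → c ∈ C₀
      D'B₁⇒C₁ : ∀ {T a b c} → Line T a b c → a ∈ D' → b ∈ B₁ → c ∈ C₁
      A'B₀⇒C₁ : ∀ {T a b c} → Line T a b c → a ∉ D' → b ∈ B₀ → c ∈ C₁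
      A'B₁⇒C₀ : ∀ {T a b c} → Line T a b c → a ∉ D' → b ∈ B₁ → c ∈ C₀

    B₀-or-B₁ : ∀ {b} → b ∈ B → b ∈ B₀ ⊎ b ∈ B₁
    B₀-or-B₁ = ∪⁻ ∘ halves (𝓣.group-size B-group) B₀∈𝓑 B₁∈𝓑 B₀⊆B B₁⊆B B₀∩B₁≡∅

    C₀-or-C₁ : ∀ {c} → c ∈ C → c ∈ C₀ ⊎ c ∈ C₁
    C₀-or-C₁ = ∪⁻ ∘ halves (𝓣.group-size C-group) C₀∈𝓑 C₁∈𝓑 C₀⊆C C₁⊆C C₀∩C₁≡∅

  module Partition (σ : Splitting) where
    open Splitting σ

    closed-D'B₀C₀ : Closed D' B₀ C₀
    closed-D'B₀C₀ ℓ = determined-by-two (toSum (_ ∈? D')) (B₀-or-B₁ (Line.b∈B ℓ)) (C₀∩C₁≡∅ _)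
                        (D'B₀⇒C₀ ℓ) (D'B₁⇒C₁ ℓ) (A'B₀⇒C₁ ℓ)

    closed-D'B₁C₁ : Closed D' B₁ C₁
    closed-D'B₁C₁ ℓ = determined-by-two (toSum (_ ∈? D')) (swap (B₀-or-B₁ (Line.b∈B ℓ))) (Disjoint-sym C₀∩C₁≡∅ _)
                        (D'B₁⇒C₁ ℓ) (D'B₀⇒C₀ ℓ) (A'B₁⇒C₀ ℓ)

    closed-A'B₀C₁ : Closed A' B₀ C₁
    closed-A'B₀C₁ ℓ = determined-by-two (swap (D'-or-A' (Line.a∈A ℓ))) (B₀-or-B₁ (Line.b∈B ℓ)) (Disjoint-sym C₀∩C₁≡∅ _)
                        (A'B₀⇒C₁ ℓ ∘ x∈p─q⇒x∉q) (A'B₁⇒C₀ ℓ ∘ x∈p─q⇒x∉q) (D'B₀⇒C₀ ℓ)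

    closed-A'B₁C₀ : Closed A' B₁ C₀
    closed-A'B₁C₀ ℓ = determined-by-two (swap (D'-or-A' (Line.a∈A ℓ))) (swap (B₀-or-B₁ (Line.b∈B ℓ))) (C₀∩C₁≡∅ _)
                        (A'B₁⇒C₀ ℓ ∘ x∈p─q⇒x∉q) (A'B₀⇒C₁ ℓ ∘ x∈p─q⇒x∉q) (D'B₁⇒C₁ ℓ)

    𝓟 : Fin 4 → Family 21
    𝓟 0F = part D' B₀ C₀
    𝓟 1F = part D' B₁ C₁
    𝓟 2F = part A' B₀ C₁
    𝓟 3F = part A' B₁ C₀

    𝓟⊆𝓣 : ∀ i → 𝓟 i ⊆ᶠ 𝓣
    𝓟⊆𝓣 0F = part⊆𝓣
    𝓟⊆𝓣 1F = part⊆𝓣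
    𝓟⊆𝓣 2F = part⊆𝓣
    𝓟⊆𝓣 3F = part⊆𝓣

    𝓟-covers : ∀ T → T ∈ᶠ 𝓣 → Σ[ i ∈ Fin 4 ] T ∈ᶠ 𝓟 i
    𝓟-covers T T∈𝓣 with line-of T∈𝓣
    ... | a , b , c , ℓ with D'-or-A' (Line.a∈A ℓ) | B₀-or-B₁ (Line.b∈B ℓ)
    ... | inj₁ a∈D' | inj₁ b∈B₀ = 0F , line∈part ℓ (closed-D'B₀C₀ ℓ (inj₁ (a∈D' , b∈B₀)))
    ... | inj₁ a∈D' | inj₂ b∈B₁ = 1F , line∈part ℓ (closed-D'B₁C₁ ℓ (inj₁ (a∈D' , b∈B₁)))
    ... | inj₂ a∈A' | inj₁ b∈B₀ = 2F , line∈part ℓ (closed-A'B₀C₁ ℓ (inj₁ (a∈A' , b∈B₀)))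
    ... | inj₂ a∈A' | inj₂ b∈B₁ = 3F , line∈part ℓ (closed-A'B₁C₀ ℓ (inj₁ (a∈A' , b∈B₁)))

    private
      D'A'-apart : ∀ {T G₂ G₃ G₂' G₃'} → T ∈ᶠ part D' G₂ G₃ → T ∈ᶠ part A' G₂' G₃' → ⊥
      D'A'-apart T∈ T∈' = 𝓣.meets-one-of A-group D'⊆A ─⁻ˡ (λ x x∈D' x∈A' → x∈p─q⇒x∉q x∈A' x∈D')
                             (proj₁ (∈part⁻ T∈)) (proj₁ (proj₂ (∈part⁻ T∈))) (proj₁ (proj₂ (∈part⁻ T∈')))
      B₀B₁-apart : ∀ {T G₁ G₃ G₁' G₃'} → T ∈ᶠ part G₁ B₀ G₃ → T ∈ᶠ part G₁' B₁ G₃' → ⊥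
      B₀B₁-apart T∈ T∈' = 𝓣.meets-one-of B-group B₀⊆B B₁⊆B B₀∩B₁≡∅
                             (proj₁ (∈part⁻ T∈)) (proj₁ (proj₂ (proj₂ (∈part⁻ T∈))))
                             (proj₁ (proj₂ (proj₂ (∈part⁻ T∈'))))

    𝓟-disjoint : ∀ i j T → T ∈ᶠ 𝓟 i → T ∈ᶠ 𝓟 j → i ≡ j
    𝓟-disjoint 0F 0F _ _ _ = refl
    𝓟-disjoint 0F 1F _ T∈ T∈' = ⊥-elim (B₀B₁-apart T∈ T∈')
    𝓟-disjoint 0F 2F _ T∈ T∈' = ⊥-elim (D'A'-apart T∈ T∈')
    𝓟-disjoint 0F 3F _ T∈ T∈' = ⊥-elim (D'A'-apart T∈ T∈')
    𝓟-disjoint 1F 0F _ T∈ T∈' = ⊥-elim (B₀B₁-apart T∈' T∈)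
    𝓟-disjoint 1F 1F _ _ _ = refl
    𝓟-disjoint 1F 2F _ T∈ T∈' = ⊥-elim (D'A'-apart T∈ T∈')
    𝓟-disjoint 1F 3F _ T∈ T∈' = ⊥-elim (D'A'-apart T∈ T∈')
    𝓟-disjoint 2F 0F _ T∈ T∈' = ⊥-elim (D'A'-apart T∈' T∈)
    𝓟-disjoint 2F 1F _ T∈ T∈' = ⊥-elim (D'A'-apart T∈' T∈)
    𝓟-disjoint 2F 2F _ _ _ = refl
    𝓟-disjoint 2F 3F _ T∈ T∈' = ⊥-elim (B₀B₁-apart T∈ T∈')
    𝓟-disjoint 3F 0F _ T∈ T∈' = ⊥-elim (D'A'-apart T∈' T∈)
    𝓟-disjoint 3F 1F _ T∈ T∈' = ⊥-elim (D'A'-apart T∈' T∈)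
    𝓟-disjoint 3F 2F _ T∈ T∈' = ⊥-elim (B₀B₁-apart T∈' T∈)
    𝓟-disjoint 3F 3F _ _ _ = refl

    𝓟-TD : ∀ i → Σ[ G₁ ∈ Subset 21 ] Σ[ G₂ ∈ Subset 21 ] Σ[ G₃ ∈ Subset 21 ]
                  ((G₁ ≡ D' ⊎ G₁ ≡ A ─ D') × (G₂ ≡ B₀ ⊎ G₂ ≡ B₁) × (G₃ ≡ C₀ ⊎ G₃ ≡ C₁) × IsTD 3 G₁ G₂ G₃ (𝓟 i))
    𝓟-TD 0F = D' , B₀ , C₀ , inj₁ refl , inj₁ refl , inj₁ refl ,
      Closed⇒IsTD D'⊆A B₀⊆B C₀⊆C ∣D'∣≡3 (block-size B₀∈𝓑) (block-size C₀∈𝓑) closed-D'B₀C₀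
    𝓟-TD 1F = D' , B₁ , C₁ , inj₁ refl , inj₂ refl , inj₂ refl ,
      Closed⇒IsTD D'⊆A B₁⊆B C₁⊆C ∣D'∣≡3 (block-size B₁∈𝓑) (block-size C₁∈𝓑) closed-D'B₁C₁
    𝓟-TD 2F = A' , B₀ , C₁ , inj₂ refl , inj₁ refl , inj₂ refl ,
      Closed⇒IsTD ─⁻ˡ B₀⊆B C₁⊆C ∣A'∣≡3 (block-size B₀∈𝓑) (block-size C₁∈𝓑) closed-A'B₀C₁
    𝓟-TD 3F = A' , B₁ , C₀ , inj₂ refl , inj₂ refl , inj₁ refl ,
      Closed⇒IsTD ─⁻ˡ B₁⊆B C₀⊆C ∣A'∣≡3 (block-size B₁∈𝓑) (block-size C₀∈𝓑) closed-A'B₁C₀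

    split-condition : SplitCondition 𝓑 𝓣 A B C D'
    split-condition = B₀ , B₁ , C₀ , C₁ , B₀∈𝓑 , B₁∈𝓑 , B₀⊆B , B₁⊆B , B₀∩B₁≡∅ , C₀∈𝓑 , C₁∈𝓑 , C₀⊆C , C₁⊆C , C₀∩C₁≡∅ ,
                      𝓟 , (𝓟⊆𝓣 , 𝓟-covers , 𝓟-disjoint) , 𝓟-TD

  module SecondTD (σ : Splitting) where
    open Splitting σ

    module SplitB = SplitPetal B∩D≡∅ petal-B ∣D∣≡3 (𝓣.group-size B-group) B₀∈𝓑 B₁∈𝓑 B₀⊆B B₁⊆B B₀∩B₁≡∅
    module SplitB' = SplitPetal B∩D≡∅ petal-B ∣D∣≡3 (𝓣.group-size B-group) B₁∈𝓑 B₀∈𝓑 B₁⊆B B₀⊆B (Disjoint-sym B₀∩B₁≡∅)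
    module SplitC = SplitPetal C∩D≡∅ petal-C ∣D∣≡3 (𝓣.group-size C-group) C₀∈𝓑 C₁∈𝓑 C₀⊆C C₁⊆C C₀∩C₁≡∅
    module SplitC' = SplitPetal C∩D≡∅ petal-C ∣D∣≡3 (𝓣.group-size C-group) C₁∈𝓑 C₀∈𝓑 C₁⊆C C₀⊆C (Disjoint-sym C₀∩C₁≡∅)

    X Y Z : Subset 21
    X = A' ∪ D
    Y = B₀ ∪ C₀
    Z = B₁ ∪ C₁

    In𝓣' : Subset 21 → Set
    In𝓣' T = T ∈ᶠ 𝓑 × ((T ∈ᶠ 𝓣 × Meets T A')
                        ⊎ (Meets T D × Meets T B₀ × Meets T B₁)
                        ⊎ (Meets T D × Meets T C₀ × Meets T C₁))

    in𝓣'? : Decidable In𝓣'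
    in𝓣'? T = (T ∈ᶠ? 𝓑) ×-dec (((T ∈ᶠ? 𝓣) ×-dec meets? A' T)
                                ⊎-dec (meets? D T ×-dec meets? B₀ T ×-dec meets? B₁ T)
                                ⊎-dec (meets? D T ×-dec meets? C₀ T ×-dec meets? C₁ T))

    𝓣' : Family 21
    𝓣' = familyOf in𝓣'?

    𝓣'⊆𝓑 : 𝓣' ⊆ᶠ 𝓑
    𝓣'⊆𝓑 T = proj₁ ∘ ∈familyOf⁻ in𝓣'?

    A'-line∈𝓣' : ∀ {T a b c} → Line T a b c → a ∈ A' → T ∈ᶠ 𝓣'
    A'-line∈𝓣' (line T∈𝓣 a∈T _ _ _ _ _) a∈A' = ∈familyOf⁺ in𝓣'? (𝓣⊆𝓑 _ T∈𝓣 , inj₁ (T∈𝓣 , _ , ∩⁺ a∈T a∈A'))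

    stem-block-B : ∀ {T} → T ∈ᶠ 𝓑 → Meets T D → Meets T B₀ → Meets T B₁ → T ∈ᶠ 𝓣'
    stem-block-B T∈𝓑 meets-D meets-B₀ meets-B₁ = ∈familyOf⁺ in𝓣'? (T∈𝓑 , inj₂ (inj₁ (meets-D , meets-B₀ , meets-B₁)))

    stem-block-C : ∀ {T} → T ∈ᶠ 𝓑 → Meets T D → Meets T C₀ → Meets T C₁ → T ∈ᶠ 𝓣'
    stem-block-C T∈𝓑 meets-D meets-C₀ meets-C₁ = ∈familyOf⁺ in𝓣'? (T∈𝓑 , inj₂ (inj₂ (meets-D , meets-C₀ , meets-C₁)))

    X∩Y≡∅ : Disjoint X Y
    X∩Y≡∅ = Disjoint-∪ˡ (Disjoint-∪ʳ (Disjoint-⊆ ─⁻ˡ B₀⊆B A∩B≡∅) (Disjoint-⊆ ─⁻ˡ C₀⊆C A∩C≡∅))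
                        (Disjoint-sym (Disjoint-∪ˡ (Disjoint-⊆ B₀⊆B id B∩D≡∅) (Disjoint-⊆ C₀⊆C id C∩D≡∅)))

    X∩Z≡∅ : Disjoint X Z
    X∩Z≡∅ = Disjoint-∪ˡ (Disjoint-∪ʳ (Disjoint-⊆ ─⁻ˡ B₁⊆B A∩B≡∅) (Disjoint-⊆ ─⁻ˡ C₁⊆C A∩C≡∅))
                        (Disjoint-sym (Disjoint-∪ˡ (Disjoint-⊆ B₁⊆B id B∩D≡∅) (Disjoint-⊆ C₁⊆C id C∩D≡∅)))

    Y∩Z≡∅ : Disjoint Y Z
    Y∩Z≡∅ = Disjoint-∪ˡ (Disjoint-∪ʳ B₀∩B₁≡∅ (Disjoint-⊆ B₀⊆B C₁⊆C B∩C≡∅))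
                        (Disjoint-∪ʳ (Disjoint-⊆ C₀⊆C B₁⊆B (Disjoint-sym B∩C≡∅)) C₀∩C₁≡∅)

    𝓣'-blocks : ∀ T → T ∈ᶠ 𝓣' → ∣ T ∣ ≡ 3 × ∣ T ∩ X ∣ ≡ 1 × ∣ T ∩ Y ∣ ≡ 1 × ∣ T ∩ Z ∣ ≡ 1
    𝓣'-blocks T T∈𝓣' = block-size T∈𝓑 , transversal (∈familyOf⁻ in𝓣'? T∈𝓣')
      where
      T∈𝓑 : T ∈ᶠ 𝓑
      T∈𝓑 = 𝓣'⊆𝓑 T T∈𝓣'
      transversal : In𝓣' T → ∣ T ∩ X ∣ ≡ 1 × ∣ T ∩ Y ∣ ≡ 1 × ∣ T ∩ Z ∣ ≡ 1
      transversal (_ , inj₂ (inj₁ ((d , d∈) , (p , p∈) , (q , q∈)))) =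
        transversal-block (block-size T∈𝓑) X∩Y≡∅ X∩Z≡∅ Y∩Z≡∅
          (∩⁺ (∩⁻ˡ d∈) (∪⁺ʳ (∩⁻ʳ d∈))) (∩⁺ (∩⁻ˡ p∈) (∪⁺ˡ (∩⁻ʳ p∈))) (∩⁺ (∩⁻ˡ q∈) (∪⁺ˡ (∩⁻ʳ q∈)))
      transversal (_ , inj₂ (inj₂ ((d , d∈) , (p , p∈) , (q , q∈)))) =
        transversal-block (block-size T∈𝓑) X∩Y≡∅ X∩Z≡∅ Y∩Z≡∅
          (∩⁺ (∩⁻ˡ d∈) (∪⁺ʳ (∩⁻ʳ d∈))) (∩⁺ (∩⁻ˡ p∈) (∪⁺ʳ (∩⁻ʳ p∈))) (∩⁺ (∩⁻ˡ q∈) (∪⁺ʳ (∩⁻ʳ q∈)))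
      transversal (_ , inj₁ (T∈𝓣 , meets-A')) =
        let _ , _ , _ , ℓ = line-of T∈𝓣 in A'-transversal ℓ (line-meets-A ℓ ─⁻ˡ meets-A') (B₀-or-B₁ (Line.b∈B ℓ))
        where
        A'-transversal : ∀ {a b c} → Line T a b c → a ∈ A' → b ∈ B₀ ⊎ b ∈ B₁ →
                         ∣ T ∩ X ∣ ≡ 1 × ∣ T ∩ Y ∣ ≡ 1 × ∣ T ∩ Z ∣ ≡ 1
        A'-transversal ℓ@(line _ a∈T b∈T c∈T _ _ _) a∈A' (inj₁ b∈B₀) =
          transversal-block (block-size T∈𝓑) X∩Y≡∅ X∩Z≡∅ Y∩Z≡∅
            (∩⁺ a∈T (∪⁺ˡ a∈A')) (∩⁺ b∈T (∪⁺ˡ b∈B₀)) (∩⁺ c∈T (∪⁺ʳ (A'B₀⇒C₁ ℓ (x∈p─q⇒x∉q a∈A') b∈B₀)))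
        A'-transversal ℓ@(line _ a∈T b∈T c∈T _ _ _) a∈A' (inj₂ b∈B₁) =
          transversal-block (block-size T∈𝓑) X∩Y≡∅ X∩Z≡∅ Y∩Z≡∅
            (∩⁺ a∈T (∪⁺ˡ a∈A')) (∩⁺ c∈T (∪⁺ʳ (A'B₁⇒C₀ ℓ (x∈p─q⇒x∉q a∈A') b∈B₁))) (∩⁺ b∈T (∪⁺ˡ b∈B₁))

    support : X ∪ Y ∪ Z ≡ ∁ D'
    support = ⊆-antisym (λ x∈XYZ → x∉p⇒x∈∁p (XYZ∩D'≡∅ _ x∈XYZ)) (λ x∈∁D' → covered (x∈∁p⇒x∉p x∈∁D') (covering _))
      where
      XYZ∩D'≡∅ : Disjoint (X ∪ Y ∪ Z) D'
      XYZ∩D'≡∅ = Disjoint-∪ˡ (Disjoint-∪ˡ (λ x x∈A' → x∈p─q⇒x∉q x∈A') D∩D'≡∅)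
                  (Disjoint-∪ˡ (Disjoint-∪ˡ (Disjoint-⊆ B₀⊆B id B∩D'≡∅) (Disjoint-⊆ C₀⊆C id C∩D'≡∅))
                               (Disjoint-∪ˡ (Disjoint-⊆ B₁⊆B id B∩D'≡∅) (Disjoint-⊆ C₁⊆C id C∩D'≡∅)))
      covered : ∀ {x} → x ∉ D' → x ∈ A ⊎ x ∈ B ⊎ x ∈ C ⊎ x ∈ D → x ∈ X ∪ Y ∪ Z
      covered x∉D' (inj₁ x∈A) = ∪⁺ˡ (∪⁺ˡ (x∈p∧x∉q⇒x∈p─q x∈A x∉D'))
      covered x∉D' (inj₂ (inj₁ x∈B)) with B₀-or-B₁ x∈B
      ... | inj₁ x∈B₀ = ∪⁺ʳ (∪⁺ˡ (∪⁺ˡ x∈B₀))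
      ... | inj₂ x∈B₁ = ∪⁺ʳ (∪⁺ʳ (∪⁺ˡ x∈B₁))
      covered x∉D' (inj₂ (inj₂ (inj₁ x∈C))) with C₀-or-C₁ x∈C
      ... | inj₁ x∈C₀ = ∪⁺ʳ (∪⁺ˡ (∪⁺ʳ x∈C₀))
      ... | inj₂ x∈C₁ = ∪⁺ʳ (∪⁺ʳ (∪⁺ʳ x∈C₁))
      covered x∉D' (inj₂ (inj₂ (inj₂ x∈D))) = ∪⁺ˡ (∪⁺ʳ x∈D)

    A'-joins : ∀ {x y} → x ∈ A' → y ∈ B ⊎ y ∈ C → Joined 𝓣' x y
    A'-joins x∈A' (inj₁ y∈B) = let T , _ , ℓ = line-AB (─⁻ˡ x∈A') y∈B in T , A'-line∈𝓣' ℓ x∈A' , Line.a∈T ℓ , Line.b∈T ℓ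
    A'-joins x∈A' (inj₂ y∈C) = let T , _ , ℓ = line-AC (─⁻ˡ x∈A') y∈C in T , A'-line∈𝓣' ℓ x∈A' , Line.a∈T ℓ , Line.c∈T ℓ

    D-joins-B₀ : ∀ {d p} → d ∈ D → p ∈ B₀ → Joined 𝓣' d p
    D-joins-B₀ d∈D p∈B₀ =
      let T , T∈𝓑 , d∈T , p∈T , meets-B₁ = SplitB.stem-joins d∈D p∈B₀
      in T , stem-block-B T∈𝓑 (_ , ∩⁺ d∈T d∈D) (_ , ∩⁺ p∈T p∈B₀) meets-B₁ , d∈T , p∈T

    D-joins-B₁ : ∀ {d p} → d ∈ D → p ∈ B₁ → Joined 𝓣' d p
    D-joins-B₁ d∈D p∈B₁ =
      let T , T∈𝓑 , d∈T , p∈T , meets-B₀ = SplitB'.stem-joins d∈D p∈B₁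
      in T , stem-block-B T∈𝓑 (_ , ∩⁺ d∈T d∈D) meets-B₀ (_ , ∩⁺ p∈T p∈B₁) , d∈T , p∈T

    D-joins-C₀ : ∀ {d p} → d ∈ D → p ∈ C₀ → Joined 𝓣' d p
    D-joins-C₀ d∈D p∈C₀ =
      let T , T∈𝓑 , d∈T , p∈T , meets-C₁ = SplitC.stem-joins d∈D p∈C₀
      in T , stem-block-C T∈𝓑 (_ , ∩⁺ d∈T d∈D) (_ , ∩⁺ p∈T p∈C₀) meets-C₁ , d∈T , p∈T

    D-joins-C₁ : ∀ {d p} → d ∈ D → p ∈ C₁ → Joined 𝓣' d p
    D-joins-C₁ d∈D p∈C₁ =
      let T , T∈𝓑 , d∈T , p∈T , meets-C₀ = SplitC'.stem-joins d∈D p∈C₁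
      in T , stem-block-C T∈𝓑 (_ , ∩⁺ d∈T d∈D) meets-C₀ (_ , ∩⁺ p∈T p∈C₁) , d∈T , p∈T

    B₀-joins-B₁ : ∀ {p q} → p ∈ B₀ → q ∈ B₁ → Joined 𝓣' p q
    B₀-joins-B₁ p∈B₀ q∈B₁ =
      let T , T∈𝓑 , p∈T , q∈T , meets-D = SplitB.cross-block-meets-stem p∈B₀ q∈B₁
      in T , stem-block-B T∈𝓑 meets-D (_ , ∩⁺ p∈T p∈B₀) (_ , ∩⁺ q∈T q∈B₁) , p∈T , q∈T

    C₀-joins-C₁ : ∀ {p q} → p ∈ C₀ → q ∈ C₁ → Joined 𝓣' p q
    C₀-joins-C₁ p∈C₀ q∈C₁ =
      let T , T∈𝓑 , p∈T , q∈T , meets-D = SplitC.cross-block-meets-stem p∈C₀ q∈C₁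
      in T , stem-block-C T∈𝓑 meets-D (_ , ∩⁺ p∈T p∈C₀) (_ , ∩⁺ q∈T q∈C₁) , p∈T , q∈T

    B₀-joins-C₁ : ∀ {b c} → b ∈ B₀ → c ∈ C₁ → Joined 𝓣' b c
    B₀-joins-C₁ b∈B₀ c∈C₁ =
      let T , _ , ℓ = line-BC (B₀⊆B b∈B₀) (C₁⊆C c∈C₁)
          a∉D' = λ a∈D' → C₀∩C₁≡∅ _ (D'B₀⇒C₀ ℓ a∈D' b∈B₀) c∈C₁
      in T , A'-line∈𝓣' ℓ (x∈p∧x∉q⇒x∈p─q (Line.a∈A ℓ) a∉D') , Line.b∈T ℓ , Line.c∈T ℓ

    B₁-joins-C₀ : ∀ {b c} → b ∈ B₁ → c ∈ C₀ → Joined 𝓣' b c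
    B₁-joins-C₀ b∈B₁ c∈C₀ =
      let T , _ , ℓ = line-BC (B₁⊆B b∈B₁) (C₀⊆C c∈C₀)
          a∉D' = λ a∈D' → C₀∩C₁≡∅ _ c∈C₀ (D'B₁⇒C₁ ℓ a∈D' b∈B₁)
      in T , A'-line∈𝓣' ℓ (x∈p∧x∉q⇒x∈p─q (Line.a∈A ℓ) a∉D') , Line.b∈T ℓ , Line.c∈T ℓ

    X-joins-Y : ∀ {x y} → x ∈ A' ⊎ x ∈ D → y ∈ B₀ ⊎ y ∈ C₀ → Joined 𝓣' x y
    X-joins-Y (inj₁ x∈A') (inj₁ y∈B₀) = A'-joins x∈A' (inj₁ (B₀⊆B y∈B₀))
    X-joins-Y (inj₁ x∈A') (inj₂ y∈C₀) = A'-joins x∈A' (inj₂ (C₀⊆C y∈C₀))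
    X-joins-Y (inj₂ x∈D) (inj₁ y∈B₀) = D-joins-B₀ x∈D y∈B₀
    X-joins-Y (inj₂ x∈D) (inj₂ y∈C₀) = D-joins-C₀ x∈D y∈C₀

    X-joins-Z : ∀ {x y} → x ∈ A' ⊎ x ∈ D → y ∈ B₁ ⊎ y ∈ C₁ → Joined 𝓣' x y
    X-joins-Z (inj₁ x∈A') (inj₁ y∈B₁) = A'-joins x∈A' (inj₁ (B₁⊆B y∈B₁))
    X-joins-Z (inj₁ x∈A') (inj₂ y∈C₁) = A'-joins x∈A' (inj₂ (C₁⊆C y∈C₁))
    X-joins-Z (inj₂ x∈D) (inj₁ y∈B₁) = D-joins-B₁ x∈D y∈B₁
    X-joins-Z (inj₂ x∈D) (inj₂ y∈C₁) = D-joins-C₁ x∈D y∈C₁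

    Y-joins-Z : ∀ {x y} → x ∈ B₀ ⊎ x ∈ C₀ → y ∈ B₁ ⊎ y ∈ C₁ → Joined 𝓣' x y
    Y-joins-Z (inj₁ x∈B₀) (inj₁ y∈B₁) = B₀-joins-B₁ x∈B₀ y∈B₁
    Y-joins-Z (inj₁ x∈B₀) (inj₂ y∈C₁) = B₀-joins-C₁ x∈B₀ y∈C₁
    Y-joins-Z (inj₂ x∈C₀) (inj₁ y∈B₁) = Joined-sym (B₁-joins-C₀ y∈B₁ x∈C₀)
    Y-joins-Z (inj₂ x∈C₀) (inj₂ y∈C₁) = C₀-joins-C₁ x∈C₀ y∈C₁

    𝓣'-pairs : ∀ x y → (x ∈ X × y ∈ Y) ⊎ (x ∈ X × y ∈ Z) ⊎ (x ∈ Y × y ∈ Z) → ExactlyOneBlock 𝓣' x y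
    𝓣'-pairs x y across = Joined⇒ExactlyOneBlock 𝓣'⊆𝓑 (distinct across) (joins across)
      where
      joins : (x ∈ X × y ∈ Y) ⊎ (x ∈ X × y ∈ Z) ⊎ (x ∈ Y × y ∈ Z) → Joined 𝓣' x y
      joins (inj₁ (x∈X , y∈Y)) = X-joins-Y (∪⁻ x∈X) (∪⁻ y∈Y)
      joins (inj₂ (inj₁ (x∈X , y∈Z))) = X-joins-Z (∪⁻ x∈X) (∪⁻ y∈Z)
      joins (inj₂ (inj₂ (x∈Y , y∈Z))) = Y-joins-Z (∪⁻ x∈Y) (∪⁻ y∈Z)
      distinct : (x ∈ X × y ∈ Y) ⊎ (x ∈ X × y ∈ Z) ⊎ (x ∈ Y × y ∈ Z) → x ≢ y
      distinct (inj₁ (x∈X , y∈Y)) = Disjoint⇒≢ X∩Y≡∅ x∈X y∈Y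
      distinct (inj₂ (inj₁ (x∈X , y∈Z))) = Disjoint⇒≢ X∩Z≡∅ x∈X y∈Z
      distinct (inj₂ (inj₂ (x∈Y , y∈Z))) = Disjoint⇒≢ Y∩Z≡∅ x∈Y y∈Z

    𝓣'≢𝓣 : ¬ (𝓣' ≐ᶠ 𝓣)
    𝓣'≢𝓣 𝓣'≐𝓣 with ∣p∣≡1+k⇒nonempty ∣D∣≡3 | ∣p∣≡1+k⇒nonempty (block-size B₀∈𝓑)
    ... | d , d∈D | p , p∈B₀ with SplitB.stem-joins d∈D p∈B₀
    ... | T , T∈𝓑 , d∈T , p∈T , meets-B₁ =
      𝓣-avoids-D (trans (sym (𝓣'≐𝓣 T)) (stem-block-B T∈𝓑 (d , ∩⁺ d∈T d∈D) (p , ∩⁺ p∈T p∈B₀) meets-B₁)) d∈T d∈D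

    other-sub-TD : HasOtherSubTD36 𝓑 𝓣 (∁ D')
    other-sub-TD = 𝓣' , X , Y , Z , 𝓣'⊆𝓑 ,
      (trans (∣p∪q∣≡∣p∣+∣q∣ A' D (Disjoint-⊆ ─⁻ˡ id A∩D≡∅)) (cong₂ _+_ ∣A'∣≡3 ∣D∣≡3) ,
       trans (∣p∪q∣≡∣p∣+∣q∣ B₀ C₀ (Disjoint-⊆ B₀⊆B C₀⊆C B∩C≡∅)) (cong₂ _+_ (block-size B₀∈𝓑) (block-size C₀∈𝓑)) ,
       trans (∣p∪q∣≡∣p∣+∣q∣ B₁ C₁ (Disjoint-⊆ B₁⊆B C₁⊆C B∩C≡∅)) (cong₂ _+_ (block-size B₁∈𝓑) (block-size C₁∈𝓑)) ,
       X∩Y≡∅ , X∩Z≡∅ , Y∩Z≡∅ , 𝓣'-blocks , 𝓣'-pairs) ,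
      support , 𝓣'≢𝓣

  Located : Subset 21 → Subset 21 → Subset 21 → Subset 21 → Fin 21 → Fin 21 → Fin 21 → Set
  Located B₀ B₁ C₀ C₁ a b c = Σ[ G₁ ∈ Subset 21 ] Σ[ G₂ ∈ Subset 21 ] Σ[ G₃ ∈ Subset 21 ]
    ((G₁ ≡ D' ⊎ G₁ ≡ A ─ D') × (G₂ ≡ B₀ ⊎ G₂ ≡ B₁) × (G₃ ≡ C₀ ⊎ G₃ ≡ C₁) ×
     Closed G₁ G₂ G₃ × a ∈ G₁ × b ∈ G₂ × c ∈ G₃)

  module SplittingFromParts {B₀ B₁ C₀ C₁ : Subset 21}
    (B₀∈𝓑 : B₀ ∈ᶠ 𝓑) (B₁∈𝓑 : B₁ ∈ᶠ 𝓑) (C₀∈𝓑 : C₀ ∈ᶠ 𝓑) (C₁∈𝓑 : C₁ ∈ᶠ 𝓑)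
    (B₀⊆B : B₀ ⊆ B) (B₁⊆B : B₁ ⊆ B) (C₀⊆C : C₀ ⊆ C) (C₁⊆C : C₁ ⊆ C)
    (B₀∩B₁≡∅ : Disjoint B₀ B₁) (C₀∩C₁≡∅ : Disjoint C₀ C₁)
    (locate : ∀ {T a b c} → Line T a b c → Located B₀ B₁ C₀ C₁ a b c)
    (closed-D'B₀C₀ : Closed D' B₀ C₀) where

    D'B₀⇒C₀ : ∀ {T a b c} → Line T a b c → a ∈ D' → b ∈ B₀ → c ∈ C₀
    D'B₀⇒C₀ ℓ a∈D' b∈B₀ = proj₂ (proj₂ (closed-D'B₀C₀ ℓ (inj₁ (a∈D' , b∈B₀))))

    D'B₁⇒C₁ : ∀ {T a b c} → Line T a b c → a ∈ D' → b ∈ B₁ → c ∈ C₁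
    D'B₁⇒C₁ ℓ a∈D' b∈B₁ with locate ℓ
    ... | _ , _ , _ , _ , _ , inj₂ refl , _ , _ , _ , c∈C₁ = c∈C₁
    ... | _ , _ , _ , _ , _ , inj₁ refl , _ , _ , _ , c∈C₀ =
      ⊥-elim (B₀∩B₁≡∅ _ (proj₁ (proj₂ (closed-D'B₀C₀ ℓ (inj₂ (inj₁ (a∈D' , c∈C₀)))))) b∈B₁)

    A'B₀⇒C₁ : ∀ {T a b c} → Line T a b c → a ∉ D' → b ∈ B₀ → c ∈ C₁
    A'B₀⇒C₁ ℓ a∉D' b∈B₀ with locate ℓ
    ... | _ , _ , _ , _ , _ , inj₂ refl , _ , _ , _ , c∈C₁ = c∈C₁
    ... | _ , _ , _ , _ , _ , inj₁ refl , _ , _ , _ , c∈C₀ =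
      ⊥-elim (a∉D' (proj₁ (closed-D'B₀C₀ ℓ (inj₂ (inj₂ (b∈B₀ , c∈C₀))))))

    -- If c ∈ C₁ the part of the line is closed for (A', B₁, C₁), which the line through b and a point
    -- of D' violates.
    A'B₁⇒C₀ : ∀ {T a b c} → Line T a b c → a ∉ D' → b ∈ B₁ → c ∈ C₀
    A'B₁⇒C₀ ℓ a∉D' b∈B₁ with locate ℓ
    ... | _ , _ , _ , _ , _ , inj₁ refl , _ , _ , _ , c∈C₀ = c∈C₀
    ... | _ , _ , _ , inj₁ refl , _ , inj₂ refl , _ , a∈D' , _ , _ = ⊥-elim (a∉D' a∈D')
    ... | _ , _ , _ , inj₂ refl , inj₁ refl , inj₂ refl , _ , _ , b∈B₀ , _ = ⊥-elim (B₀∩B₁≡∅ _ b∈B₀ b∈B₁)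
    ... | _ , _ , _ , inj₂ refl , inj₂ refl , inj₂ refl , closed-A'B₁C₁ , _ , _ , _ =
      let e , e∈D' = ∣p∣≡1+k⇒nonempty ∣D'∣≡3
          _ , _ , ℓ' = line-AB (D'⊆A e∈D') (Line.b∈B ℓ)
          e∈A' = proj₁ (closed-A'B₁C₁ ℓ' (inj₂ (inj₂ (b∈B₁ , D'B₁⇒C₁ ℓ' e∈D' b∈B₁))))
      in ⊥-elim (x∈p─q⇒x∉q e∈A' e∈D')

    splitting : Splitting
    splitting = record
      { B₀ = B₀ ; B₁ = B₁ ; C₀ = C₀ ; C₁ = C₁
      ; B₀∈𝓑 = B₀∈𝓑 ; B₁∈𝓑 = B₁∈𝓑 ; C₀∈𝓑 = C₀∈𝓑 ; C₁∈𝓑 = C₁∈𝓑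
      ; B₀⊆B = B₀⊆B ; B₁⊆B = B₁⊆B ; C₀⊆C = C₀⊆C ; C₁⊆C = C₁⊆C
      ; B₀∩B₁≡∅ = B₀∩B₁≡∅ ; C₀∩C₁≡∅ = C₀∩C₁≡∅
      ; D'B₀⇒C₀ = D'B₀⇒C₀ ; D'B₁⇒C₁ = D'B₁⇒C₁ ; A'B₀⇒C₁ = A'B₀⇒C₁ ; A'B₁⇒C₀ = A'B₁⇒C₀ }

  -- The part containing a line through D' and B₀ has groups D', B₀ and C₀ or C₁; in the second case
  -- C₀ and C₁ swap roles.
  split-condition⇒splitting : SplitCondition 𝓑 𝓣 A B C D' → Splitting
  split-condition⇒splitting
    (B₀ , B₁ , C₀ , C₁ , B₀∈𝓑 , B₁∈𝓑 , B₀⊆B , B₁⊆B , B₀∩B₁≡∅ , C₀∈𝓑 , C₁∈𝓑 , C₀⊆C , C₁⊆C , C₀∩C₁≡∅ ,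
     𝓟 , (𝓟⊆𝓣 , 𝓟-covers , _) , 𝓟-TD) =
    let e , e∈D' = ∣p∣≡1+k⇒nonempty ∣D'∣≡3
        p , p∈B₀ = ∣p∣≡1+k⇒nonempty (block-size B₀∈𝓑)
    in from-first-line e∈D' p∈B₀ (locate (proj₂ (proj₂ (line-AB (D'⊆A e∈D') (B₀⊆B p∈B₀)))))
    where
    locate : ∀ {T a b c} → Line T a b c → Located B₀ B₁ C₀ C₁ a b c
    locate ℓ =
      let i , T∈𝓟ᵢ = 𝓟-covers _ (Line.T∈𝓣 ℓ)
          G₁ , G₂ , G₃ , G₁≡ , G₂≡ , G₃≡ , 𝓟ᵢ-TD = 𝓟-TD i
          G₁⊆A = either-⊆ G₁≡ D'⊆A ─⁻ˡ
          G₂⊆B = either-⊆ G₂≡ B₀⊆B B₁⊆B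
          G₃⊆C = either-⊆ G₃≡ C₀⊆C C₁⊆C
      in G₁ , G₂ , G₃ , G₁≡ , G₂≡ , G₃≡ , sub-TD⇒Closed 𝓟ᵢ-TD (𝓟⊆𝓣 i) G₁⊆A G₂⊆B G₃⊆C ,
         sub-TD-points 𝓟ᵢ-TD (𝓟⊆𝓣 i) G₁⊆A G₂⊆B G₃⊆C ℓ T∈𝓟ᵢ
    swap-C : ∀ {a b c} → Located B₀ B₁ C₀ C₁ a b c → Located B₀ B₁ C₁ C₀ a b c
    swap-C (G₁ , G₂ , G₃ , G₁≡ , G₂≡ , G₃≡ , rest) = G₁ , G₂ , G₃ , G₁≡ , G₂≡ , swap G₃≡ , rest
    from-first-line : ∀ {e p c} → e ∈ D' → p ∈ B₀ → Located B₀ B₁ C₀ C₁ e p c → Splitting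
    from-first-line e∈D' _ (_ , _ , _ , inj₂ refl , _ , _ , _ , e∈A' , _ , _) = ⊥-elim (x∈p─q⇒x∉q e∈A' e∈D')
    from-first-line _ p∈B₀ (_ , _ , _ , inj₁ refl , inj₂ refl , _ , _ , _ , p∈B₁ , _) = ⊥-elim (B₀∩B₁≡∅ _ p∈B₀ p∈B₁)
    from-first-line _ _ (_ , _ , _ , inj₁ refl , inj₁ refl , inj₁ refl , closed-D'B₀C₀ , _) =
      SplittingFromParts.splitting B₀∈𝓑 B₁∈𝓑 C₀∈𝓑 C₁∈𝓑 B₀⊆B B₁⊆B C₀⊆C C₁⊆C B₀∩B₁≡∅ C₀∩C₁≡∅ locate closed-D'B₀C₀
    from-first-line _ _ (_ , _ , _ , inj₁ refl , inj₁ refl , inj₂ refl , closed-D'B₀C₁ , _) =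
      SplittingFromParts.splitting B₀∈𝓑 B₁∈𝓑 C₁∈𝓑 C₀∈𝓑 B₀⊆B B₁⊆B C₁⊆C C₀⊆C B₀∩B₁≡∅ (Disjoint-sym C₀∩C₁≡∅)
        (swap-C ∘ locate) closed-D'B₀C₁

  module FromSecondTD {𝓣' : Family 21} {X Y Z : Subset 21}
    (𝓣'⊆𝓑 : 𝓣' ⊆ᶠ 𝓑) (𝓣'-TD : IsTD 6 X Y Z 𝓣') (support : X ∪ Y ∪ Z ≡ ∁ D') where

    module 𝓣' = TransversalDesign 𝓣'-TD
    open 𝓣' using (Group)

    group-of : ∀ {x} → x ∉ D' → Σ[ G ∈ Subset 21 ] (Group G × x ∈ G)
    group-of {x} x∉D' with ∪⁻ (subst (x ∈_) (sym support) (x∉p⇒x∈∁p x∉D'))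
    ... | inj₁ x∈X = X , inj₁ refl , x∈X
    ... | inj₂ x∈Y∪Z with ∪⁻ x∈Y∪Z
    ... | inj₁ x∈Y = Y , inj₂ (inj₁ refl) , x∈Y
    ... | inj₂ x∈Z = Z , inj₂ (inj₂ refl) , x∈Z

    𝓣'-avoids-D' : ∀ {T x} → T ∈ᶠ 𝓣' → x ∈ T → x ∉ D'
    𝓣'-avoids-D' T∈𝓣' x∈T = x∈∁p⇒x∉p (subst (_ ∈_) support (𝓣'.block⊆support T∈𝓣' x∈T))

    stays-in-group : ∀ {G T u v} → Group G → u ∈ G → v ∉ D' → T ∈ᶠ 𝓑 → u ∈ T → v ∈ T → u ≢ v →
                     ¬ (T ∈ᶠ 𝓣') → v ∈ G
    stays-in-group {G} {v = v} G-group u∈G v∉D' T∈𝓑 u∈T v∈T u≢v T∉𝓣' with v ∈? G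
    ... | yes v∈G = v∈G
    ... | no v∉G with group-of v∉D'
    ... | H , H-group , v∈H with 𝓣'.pair-across G-group H-group u∈G v∈H v∉G
    ... | U , U∈𝓣' , u∈U , v∈U , _ =
      ⊥-elim (T∉𝓣' (subst (_∈ᶠ 𝓣') (block-unique (𝓣'⊆𝓑 U U∈𝓣') T∈𝓑 u∈U v∈U u∈T v∈T u≢v) U∈𝓣'))

    D'-line-stays-in-group : ∀ {G T e b c} → Group G → Line T e b c → e ∈ D' → b ∈ G ⊎ c ∈ G → b ∈ G × c ∈ G
    D'-line-stays-in-group {G} {T} {e} {b} {c} G-group (line T∈𝓣 e∈T b∈T c∈T _ b∈B c∈C) e∈D' = both
      where
      T∉𝓣' : ¬ (T ∈ᶠ 𝓣')
      T∉𝓣' T∈𝓣' = 𝓣'-avoids-D' T∈𝓣' e∈T e∈D'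
      b≢c : b ≢ c
      b≢c = Disjoint⇒≢ B∩C≡∅ b∈B c∈C
      both : b ∈ G ⊎ c ∈ G → b ∈ G × c ∈ G
      both (inj₁ b∈G) = b∈G , stays-in-group G-group b∈G (C∩D'≡∅ _ c∈C) (𝓣⊆𝓑 _ T∈𝓣) b∈T c∈T b≢c T∉𝓣'
      both (inj₂ c∈G) = stays-in-group G-group c∈G (B∩D'≡∅ _ b∈B) (𝓣⊆𝓑 _ T∈𝓣) c∈T b∈T (b≢c ∘ sym) T∉𝓣' , c∈G

    ThroughD' : Fin 21 → Fin 21 → Set
    ThroughD' b c = Σ[ e ∈ Fin 21 ] (e ∈ D' × Σ[ T ∈ Subset 21 ] Line T e b c)

    fan-B : ∀ {b} → b ∈ B → Σ[ cs ∈ List (Fin 21) ] (length cs ≡ 3 × Unique cs × All (ThroughD' b) cs)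
    fan-B b∈B = image₃ ∣D'∣≡3 (λ e∈D' → let T , c , ℓ = line-AB (D'⊆A e∈D') b∈B in c , T , ℓ)
                       (λ _ _ (_ , ℓ) (_ , ℓ') → line-unique-A ℓ ℓ')

    fan-C : ∀ {c} → c ∈ C → Σ[ bs ∈ List (Fin 21) ] (length bs ≡ 3 × Unique bs × All (λ b → ThroughD' b c) bs)
    fan-C c∈C = image₃ ∣D'∣≡3 (λ e∈D' → let T , b , ℓ = line-AC (D'⊆A e∈D') c∈C in b , T , ℓ)
                       (λ _ _ (_ , ℓ) (_ , ℓ') → line-unique-A ℓ ℓ')

    group∩petal∈𝓑 : ∀ {G P p₁ p₂ p₃} → Group G → Disjoint G D → Disjoint P D → Petal 𝓑 P D → Disjoint P D' →
                    p₁ ∈ G ∩ P → p₂ ∈ G ∩ P → p₁ ≢ p₂ → (∀ {x} → x ∈ G ∩ P → x ∈ₗ p₁ ∷ p₂ ∷ p₃ ∷ []) →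
                    (G ∩ P) ∈ᶠ 𝓑
    group∩petal∈𝓑 {G} {P} {p₁} {p₂} {p₃} G-group G∩D≡∅ P∩D≡∅ petal P∩D'≡∅ p₁∈G∩P p₂∈G∩P p₁≢p₂ G∩P⊆p₁p₂p₃ =
      close (pair-block p₁≢p₂)
      where
      close : Joined 𝓑 p₁ p₂ → (G ∩ P) ∈ᶠ 𝓑
      close (T , T∈𝓑 , p₁∈T , p₂∈T) with third-point (block-size T∈𝓑) p₁ p₂
      ... | t , t∈T , t≢p₁ , t≢p₂ = subst (_∈ᶠ 𝓑) (⊆-antisym T⊆G∩P G∩P⊆T) T∈𝓑
        where
        p₁≢t : p₁ ≢ t
        p₁≢t = t≢p₁ ∘ sym
        p₂≢t : p₂ ≢ t
        p₂≢t = t≢p₂ ∘ sym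
        t∈P∪D : t ∈ P ∪ D
        t∈P∪D = petal-closed P∩D≡∅ petal T∈𝓑 p₁∈T p₂∈T p₁≢p₂ (∩⁻ʳ p₁∈G∩P) (∪⁺ˡ (∩⁻ʳ p₂∈G∩P)) t∈T
        t∈G : t ∈ G
        t∈G = stays-in-group G-group (∩⁻ˡ p₁∈G∩P) (Disjoint-∪ˡ P∩D'≡∅ D∩D'≡∅ t t∈P∪D)
                T∈𝓑 p₁∈T t∈T p₁≢t
                (λ T∈𝓣' → p₁≢p₂ (𝓣'.one-point-per-group G-group T∈𝓣' p₁∈T p₂∈T (∩⁻ˡ p₁∈G∩P) (∩⁻ˡ p₂∈G∩P)))
        t∈G∩P : t ∈ G ∩ P
        t∈G∩P with ∪⁻ t∈P∪D
        ... | inj₁ t∈P = ∩⁺ t∈G t∈P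
        ... | inj₂ t∈D = ⊥-elim (G∩D≡∅ t t∈G t∈D)
        T⊆G∩P : T ⊆ G ∩ P
        T⊆G∩P y∈T with ∣p∣≡length⇒⊆ ((p₁≢p₂ ∷ p₁≢t ∷ []) ∷ (p₂≢t ∷ []) ∷ [] ∷ []) (p₁∈T ∷ p₂∈T ∷ t∈T ∷ [])
                                     (block-size T∈𝓑) y∈T
        ... | here refl = p₁∈G∩P
        ... | there (here refl) = p₂∈G∩P
        ... | there (there (here refl)) = t∈G∩P
        G∩P⊆T : G ∩ P ⊆ T
        G∩P⊆T x∈G∩P with G∩P⊆p₁p₂p₃ x∈G∩P
        ... | here refl = p₁∈T
        ... | there (here refl) = p₂∈T
        ... | there (there (here refl)) with G∩P⊆p₁p₂p₃ t∈G∩P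
        ...   | here t≡p₁ = ⊥-elim (p₁≢t (sym t≡p₁))
        ...   | there (here t≡p₂) = ⊥-elim (p₂≢t (sym t≡p₂))
        ...   | there (there (here t≡p₃)) = subst (_∈ T) t≡p₃ t∈T

    -- The six given points fill G (∣ G ∣ ≡ 6), so G avoids the stem D.
    group∩B∈𝓑∧group∩C∈𝓑 : ∀ {G b₁ b₂ b₃ c₁ c₂ c₃} → Group G →
                          Unique (b₁ ∷ b₂ ∷ b₃ ∷ []) → All (_∈ G ∩ B) (b₁ ∷ b₂ ∷ b₃ ∷ []) →
                          Unique (c₁ ∷ c₂ ∷ c₃ ∷ []) → All (_∈ G ∩ C) (c₁ ∷ c₂ ∷ c₃ ∷ []) →
                          (G ∩ B) ∈ᶠ 𝓑 × (G ∩ C) ∈ᶠ 𝓑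
    group∩B∈𝓑∧group∩C∈𝓑 {G} {b₁} {b₂} {b₃} {c₁} {c₂} {c₃} G-group
      bs!@((b₁≢b₂ ∷ _) ∷ _) bs⊆G∩B@(b₁∈ ∷ b₂∈ ∷ _) cs!@((c₁≢c₂ ∷ _) ∷ _) cs⊆G∩C@(c₁∈ ∷ c₂∈ ∷ _) =
      group∩petal∈𝓑 G-group G∩D≡∅ B∩D≡∅ petal-B B∩D'≡∅ b₁∈ b₂∈ b₁≢b₂ G∩B⊆bs ,
      group∩petal∈𝓑 G-group G∩D≡∅ C∩D≡∅ petal-C C∩D'≡∅ c₁∈ c₂∈ c₁≢c₂ G∩C⊆cs
      where
      bs cs : List (Fin 21)
      bs = b₁ ∷ b₂ ∷ b₃ ∷ []
      cs = c₁ ∷ c₂ ∷ c₃ ∷ []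
      G⊆bs++cs : ∀ {x} → x ∈ G → x ∈ₗ bs ++ cs
      G⊆bs++cs = ∣p∣≡length⇒⊆
        (Unique.++⁺ bs! cs! (λ (x∈bs , x∈cs) → B∩C≡∅ _ (∩⁻ʳ (All.lookup bs⊆G∩B x∈bs)) (∩⁻ʳ (All.lookup cs⊆G∩C x∈cs))))
        (All-++⁺ (All.map ∩⁻ˡ bs⊆G∩B) (All.map ∩⁻ˡ cs⊆G∩C)) (𝓣'.group-size G-group)
      G⊆B∪C : ∀ {x} → x ∈ G → x ∈ G ∩ B ⊎ x ∈ G ∩ C
      G⊆B∪C x∈G with ∈-++⁻ bs (G⊆bs++cs x∈G)
      ... | inj₁ x∈bs = inj₁ (All.lookup bs⊆G∩B x∈bs)
      ... | inj₂ x∈cs = inj₂ (All.lookup cs⊆G∩C x∈cs)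
      G∩D≡∅ : Disjoint G D
      G∩D≡∅ x x∈G x∈D with G⊆B∪C x∈G
      ... | inj₁ x∈G∩B = B∩D≡∅ x (∩⁻ʳ x∈G∩B) x∈D
      ... | inj₂ x∈G∩C = C∩D≡∅ x (∩⁻ʳ x∈G∩C) x∈D
      G∩B⊆bs : ∀ {x} → x ∈ G ∩ B → x ∈ₗ bs
      G∩B⊆bs x∈G∩B with ∈-++⁻ bs (G⊆bs++cs (∩⁻ˡ x∈G∩B))
      ... | inj₁ x∈bs = x∈bs
      ... | inj₂ x∈cs = ⊥-elim (B∩C≡∅ _ (∩⁻ʳ x∈G∩B) (∩⁻ʳ (All.lookup cs⊆G∩C x∈cs)))
      G∩C⊆cs : ∀ {x} → x ∈ G ∩ C → x ∈ₗ cs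
      G∩C⊆cs x∈G∩C with ∈-++⁻ bs (G⊆bs++cs (∩⁻ˡ x∈G∩C))
      ... | inj₁ x∈bs = ⊥-elim (B∩C≡∅ _ (∩⁻ʳ (All.lookup bs⊆G∩B x∈bs)) (∩⁻ʳ x∈G∩C))
      ... | inj₂ x∈cs = x∈cs

    group-halves : ∀ {G b} → Group G → b ∈ G → b ∈ B → (G ∩ B) ∈ᶠ 𝓑 × (G ∩ C) ∈ᶠ 𝓑
    group-halves {G} G-group b∈G b∈B with fan-B b∈B
    ... | _ ∷ _ ∷ _ ∷ [] , refl , cs! , cs-lines@((_ , _ , _ , ℓ₁) ∷ _) with fan-C (Line.c∈C ℓ₁)
    ... | _ ∷ _ ∷ _ ∷ [] , refl , bs! , bs-lines = group∩B∈𝓑∧group∩C∈𝓑 G-group bs! bs⊆G∩B cs! cs⊆G∩C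
      where
      cs⊆G∩C : All (_∈ G ∩ C) _
      cs⊆G∩C = All.map (λ (_ , e∈D' , _ , ℓ) →
        ∩⁺ (proj₂ (D'-line-stays-in-group G-group ℓ e∈D' (inj₁ b∈G))) (Line.c∈C ℓ)) cs-lines
      bs⊆G∩B : All (_∈ G ∩ B) _
      bs⊆G∩B = All.map (λ (_ , e∈D' , _ , ℓ) →
        ∩⁺ (proj₁ (D'-line-stays-in-group G-group ℓ e∈D' (inj₂ (∩⁻ˡ (All.head cs⊆G∩C))))) (Line.b∈B ℓ)) bs-lines

    -- The lines through b and the three points of D' meet the block G ∩ C in three distinct points.
    line-in-group⇒through-D' : ∀ {G T a b c} → Group G → (G ∩ C) ∈ᶠ 𝓑 → Line T a b c → b ∈ G → c ∈ G → a ∈ D'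
    line-in-group⇒through-D' {G} {b = b} G-group G∩C∈𝓑 ℓ b∈G c∈G =
      let e , e∈D' , _ , ℓ' = onto₃ ∣D'∣≡3 (block-size G∩C∈𝓑) D'-line (λ _ _ _ (_ , ℓ₁) (_ , ℓ₂) → line-unique-A ℓ₁ ℓ₂)
                                    (∩⁺ c∈G (Line.c∈C ℓ))
      in subst (_∈ D') (sym (line-unique-A ℓ ℓ')) e∈D'
      where
      D'-line : ∀ {e} → e ∈ D' → Σ[ c ∈ Fin 21 ] (c ∈ G ∩ C × Σ[ T ∈ Subset 21 ] Line T e b c)
      D'-line e∈D' =
        let T , c , ℓ' = line-AB (D'⊆A e∈D') (Line.b∈B ℓ)
        in c , ∩⁺ (proj₂ (D'-line-stays-in-group G-group ℓ' e∈D' (inj₁ b∈G))) (Line.c∈C ℓ') , T , ℓ'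

    module TwoGroups {G H : Subset 21} (G-group : Group G) (H-group : Group H) (G∩H≡∅ : Disjoint G H)
                     (G∩B∈𝓑 : (G ∩ B) ∈ᶠ 𝓑) (G∩C∈𝓑 : (G ∩ C) ∈ᶠ 𝓑) (H∩B∈𝓑 : (H ∩ B) ∈ᶠ 𝓑) (H∩C∈𝓑 : (H ∩ C) ∈ᶠ 𝓑) where

      G∩C-or-H∩C : ∀ {c} → c ∈ C → c ∈ G ∩ C ⊎ c ∈ H ∩ C
      G∩C-or-H∩C = ∪⁻ ∘ halves (𝓣.group-size C-group) G∩C∈𝓑 H∩C∈𝓑 ∩⁻ʳ ∩⁻ʳ (Disjoint-⊆ ∩⁻ˡ ∩⁻ˡ G∩H≡∅)

      splitting : Splitting
      splitting = record
        { B₀ = G ∩ B ; B₁ = H ∩ B ; C₀ = G ∩ C ; C₁ = H ∩ C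
        ; B₀∈𝓑 = G∩B∈𝓑 ; B₁∈𝓑 = H∩B∈𝓑 ; C₀∈𝓑 = G∩C∈𝓑 ; C₁∈𝓑 = H∩C∈𝓑
        ; B₀⊆B = ∩⁻ʳ ; B₁⊆B = ∩⁻ʳ ; C₀⊆C = ∩⁻ʳ ; C₁⊆C = ∩⁻ʳ
        ; B₀∩B₁≡∅ = Disjoint-⊆ ∩⁻ˡ ∩⁻ˡ G∩H≡∅ ; C₀∩C₁≡∅ = Disjoint-⊆ ∩⁻ˡ ∩⁻ˡ G∩H≡∅
        ; D'B₀⇒C₀ = λ ℓ a∈D' b∈G∩B → ∩⁺ (proj₂ (D'-line-stays-in-group G-group ℓ a∈D' (inj₁ (∩⁻ˡ b∈G∩B)))) (Line.c∈C ℓ)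
        ; D'B₁⇒C₁ = λ ℓ a∈D' b∈H∩B → ∩⁺ (proj₂ (D'-line-stays-in-group H-group ℓ a∈D' (inj₁ (∩⁻ˡ b∈H∩B)))) (Line.c∈C ℓ)
        ; A'B₀⇒C₁ = A'B₀⇒C₁
        ; A'B₁⇒C₀ = A'B₁⇒C₀ }
        where
        A'B₀⇒C₁ : ∀ {T a b c} → Line T a b c → a ∉ D' → b ∈ G ∩ B → c ∈ H ∩ C
        A'B₀⇒C₁ ℓ a∉D' b∈G∩B with G∩C-or-H∩C (Line.c∈C ℓ)
        ... | inj₂ c∈H∩C = c∈H∩C
        ... | inj₁ c∈G∩C = ⊥-elim (a∉D' (line-in-group⇒through-D' G-group G∩C∈𝓑 ℓ (∩⁻ˡ b∈G∩B) (∩⁻ˡ c∈G∩C)))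
        A'B₁⇒C₀ : ∀ {T a b c} → Line T a b c → a ∉ D' → b ∈ H ∩ B → c ∈ G ∩ C
        A'B₁⇒C₀ ℓ a∉D' b∈H∩B with G∩C-or-H∩C (Line.c∈C ℓ)
        ... | inj₁ c∈G∩C = c∈G∩C
        ... | inj₂ c∈H∩C = ⊥-elim (a∉D' (line-in-group⇒through-D' H-group H∩C∈𝓑 ℓ (∩⁻ˡ b∈H∩B) (∩⁻ˡ c∈H∩C)))

    splitting : Splitting
    splitting =
      let b , b∈B = ∣p∣≡1+k⇒nonempty (𝓣.group-size B-group)
          G , G-group , b∈G = group-of (B∩D'≡∅ _ b∈B)
          G∩B∈𝓑 , G∩C∈𝓑 = group-halves G-group b∈G b∈B
          ∣G∩B∣<∣B∣ = subst₂ _<_ (sym (block-size G∩B∈𝓑)) (sym (𝓣.group-size B-group)) (s≤s (s≤s (s≤s (s≤s z≤n))))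
          b' , b'∈B , b'∉G∩B = ∣q∣<∣p∣⇒∃∈p∉q ∣G∩B∣<∣B∣
          H , H-group , b'∈H = group-of (B∩D'≡∅ _ b'∈B)
          H∩B∈𝓑 , H∩C∈𝓑 = group-halves H-group b'∈H b'∈B
          G∩H≡∅ = λ x x∈G x∈H → b'∉G∩B (∩⁺ (subst (b' ∈_) (sym (𝓣'.group-unique G-group H-group x∈G x∈H)) b'∈H) b'∈B)
      in TwoGroups.splitting G-group H-group G∩H≡∅ G∩B∈𝓑 G∩C∈𝓑 H∩B∈𝓑 H∩C∈𝓑

petals : ∀ {𝓑 : Family 21} {A B C D} →
  (HasSubSTS9 𝓑 (A ∪ D) × HasAlmostSubSTS9 𝓑 (B ∪ D) D × HasAlmostSubSTS9 𝓑 (C ∪ D) D)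
  ⊎ (HasAlmostSubSTS9 𝓑 (A ∪ D) D × HasSubSTS9 𝓑 (B ∪ D) × HasAlmostSubSTS9 𝓑 (C ∪ D) D)
  ⊎ (HasAlmostSubSTS9 𝓑 (A ∪ D) D × HasAlmostSubSTS9 𝓑 (B ∪ D) D × HasSubSTS9 𝓑 (C ∪ D)) →
  Petal 𝓑 B D × Petal 𝓑 C D
petals (inj₁ (_ , B∪D , C∪D)) = inj₂ B∪D , inj₂ C∪D
petals (inj₂ (inj₁ (_ , B∪D , C∪D))) = inj₁ B∪D , inj₂ C∪D
petals (inj₂ (inj₂ (_ , B∪D , C∪D))) = inj₂ B∪D , inj₁ C∪D

lemma6 : (𝓑 : Family 21) (A B C D D' : Subset 21) (𝓣 : Family 21) →
    IsSTS ⊤ 𝓑 → IsFlower 𝓑 A B C D →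
    𝓣 ⊆ᶠ 𝓑 → IsTD 6 A B C 𝓣 →
    ∣ D' ∣ ≡ 3 → D' ⊆ A →
    HasOtherSubTD36 𝓑 𝓣 (∁ D') ⇔ SplitCondition 𝓑 𝓣 A B C D'
lemma6 𝓑 A B C D D' 𝓣 sts (_ , _ , _ , ∣D∣≡3 , _ , _ , A∩D≡∅ , _ , B∩D≡∅ , C∩D≡∅ , covering , flower)
       𝓣⊆𝓑 𝓣-TD ∣D'∣≡3 D'⊆A =
  mk⇔ (λ (_ , _ , _ , _ , 𝓣'⊆𝓑 , 𝓣'-TD , support , _) →
         Partition.split-condition (FromSecondTD.splitting 𝓣'⊆𝓑 𝓣'-TD support))
      (SecondTD.other-sub-TD ∘ split-condition⇒splitting)
  where
  open Flower sts A∩D≡∅ B∩D≡∅ C∩D≡∅ covering ∣D∣≡3 (proj₁ (petals flower)) (proj₂ (petals flower))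
              𝓣⊆𝓑 𝓣-TD ∣D'∣≡3 D'⊆A
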